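{- Let $G=(V,E)$ be a finite graph and $n=|V|$. Then $\mu(G)-\mu'(G)=p(G)-e_p(G)$. In particular, $\mu'(G)=\frac{n-2p(G)+e_p(G)}{2}$.
   Context: $\lambda(G)=\max\{|H|+|H'| : H,H' \text{ disjoint matchings of } G\}$, $\Lambda(G)$ the set of pairs of disjoint matchings $(H,H')$ with $|H|+|H'|=\lambda(G)$, $\mu(G)=\max\{|H|:(H,H')\in\Lambda(G)\}$, and $\mu'(G)=\lambda(G)-\mu(G)$. A pec decomposition of $G$ is a spanning subgraph $G'=(V,E')$, $E'\subseteq E$, whose connected components are paths or even-length cycles (an isolated vertex is a path of length $0$, hence even). $p(G')$, $e(G')$ are the numbers of components that are paths, resp. even paths; $p(G)=\min p(G')$ over pec decompositions, and $e_p(G)=\min\{e(G') : G' \text{ pec decomposition with } p(G')=p(G)\}$. -}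

module Defs where

open import Data.Nat using (ℕ; zero; suc; _+_; _≤_; _%_)
open import Data.Bool using (Bool; true; false)
open import Data.Fin using (Fin; zero; suc; inject₁; fromℕ)
open import Data.Fin.Subset using (Subset; _∈_; ∣_∣)
open import Data.Vec using (tabulate)
open import Data.Product using (Σ; _×_; _,_; proj₁; proj₂; ∃; ∃-syntax)
open import Data.Sum using (_⊎_)
open import Function.Definitions using (Injective)
open import Relation.Binary.PropositionalEquality using (_≡_; _≢_)
open import Relation.Nullary using (¬_)
open import Data.Empty using (⊥)

-- Finite graphs: vertex set Fin n, edge set Fin m, each edge has two
-- distinct endpoints (no loops; parallel edges allowed).

record Graph : Set where
  field
    n        : ℕ
    m        : ℕ
    ends     : Fin m → Fin n × Fin n
    loopless : ∀ e → proj₁ (ends e) ≢ proj₂ (ends e)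

open Graph public

module _ (G : Graph) where

  Vtx : Set
  Vtx = Fin (n G)

  Edg : Set
  Edg = Fin (m G)

  Incident : Vtx → Edg → Set
  Incident v e = v ≡ proj₁ (ends G e) ⊎ v ≡ proj₂ (ends G e)

  Joins : Edg → Vtx → Vtx → Set
  Joins e u v = ends G e ≡ (u , v) ⊎ ends G e ≡ (v , u)

  IsMatching : Subset (m G) → Set
  IsMatching H = ∀ e f → e ∈ H → f ∈ H → e ≢ f →
                 ¬ (Σ Vtx λ v → Incident v e × Incident v f)

  DisjointSets : Subset (m G) → Subset (m G) → Set
  DisjointSets H H' = ∀ e → e ∈ H → e ∈ H' → ⊥

  DisjMatchings : Subset (m G) → Subset (m G) → Set
  DisjMatchings H H' = IsMatching H × IsMatching H' × DisjointSets H H'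

  IsLambda : ℕ → Set
  IsLambda l = (Σ (Subset (m G)) λ H → Σ (Subset (m G)) λ H' →
                  DisjMatchings H H' × ∣ H ∣ + ∣ H' ∣ ≡ l)
             × (∀ H H' → DisjMatchings H H' → ∣ H ∣ + ∣ H' ∣ ≤ l)

  InΛ : ℕ → Subset (m G) → Subset (m G) → Set
  InΛ l H H' = DisjMatchings H H' × ∣ H ∣ + ∣ H' ∣ ≡ l

  IsMu : ℕ → ℕ → Set
  IsMu l k = (Σ (Subset (m G)) λ H → Σ (Subset (m G)) λ H' →
                InΛ l H H' × ∣ H ∣ ≡ k)
           × (∀ H H' → InΛ l H H' → ∣ H ∣ ≤ k)

  -- A path of length k: distinct vertices vs 0 … vs k, distinct edges
  -- es 0 … es (k-1), edge es i joining vs i and vs (i+1).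
  -- An even cycle of length k+1 (k+1 even, k ≥ 1): a path of length k
  -- as above plus a further edge c (different from the es i) joining
  -- vs k and vs 0.

  record PathData : Set where
    field
      len     : ℕ
      vs      : Fin (suc len) → Vtx
      es      : Fin len → Edg
      vs-inj  : Injective _≡_ _≡_ vs
      es-inj  : Injective _≡_ _≡_ es
      joins   : ∀ (i : Fin len) → Joins (es i) (vs (inject₁ i)) (vs (suc i))

  data Component : Set where
    path      : PathData → Component
    evenCycle : (P : PathData) (c : Edg) →
                1 ≤ PathData.len P →
                suc (PathData.len P) % 2 ≡ 0 →
                (∀ i → PathData.es P i ≢ c) →
                Joins c (PathData.vs P (fromℕ (PathData.len P))) (PathData.vs P zero) →
                Component

  compPath : Component → PathData
  compPath (path P) = P
  compPath (evenCycle P _ _ _ _ _) = P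

  InComp : Vtx → Component → Set
  InComp v C = Σ (Fin (suc (PathData.len (compPath C)))) λ i → PathData.vs (compPath C) i ≡ v

  isPath : Component → Bool
  isPath (path _) = true
  isPath (evenCycle _ _ _ _ _ _) = false

  isEvenPath : Component → Bool
  isEvenPath (path P) with PathData.len P % 2
  ... | zero  = true
  ... | suc _ = false
  isEvenPath (evenCycle _ _ _ _ _ _) = false

  -- A pec decomposition G' = (V, E'): a family of components whose vertex
  -- sets partition V; E' is the union of the components' edges, so these
  -- are exactly the connected components of G'.
  record PecDecomp : Set where
    field
      c       : ℕ
      comp    : Fin c → Component
      covers  : ∀ v → Σ (Fin c) λ i → InComp v (comp i)
      disjoint : ∀ v i j → InComp v (comp i) → InComp v (comp j) → i ≡ j

  pCount : PecDecomp → ℕ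
  pCount D = ∣ tabulate (λ i → isPath (PecDecomp.comp D i)) ∣

  eCount : PecDecomp → ℕ
  eCount D = ∣ tabulate (λ i → isEvenPath (PecDecomp.comp D i)) ∣

  IsP : ℕ → Set
  IsP p = (Σ PecDecomp λ D → pCount D ≡ p) × (∀ D → p ≤ pCount D)

  IsEp : ℕ → ℕ → Set
  IsEp p e = (Σ PecDecomp λ D → pCount D ≡ p × eCount D ≡ e)
           × (∀ D → pCount D ≡ p → e ≤ eCount D)

-- Colouring each component of a pec decomposition G′ alternately yields two disjoint matchings H, H′
-- with |H| + |H′| = n − p(G′) and |H| − |H′| = p(G′) − e(G′): only a path of odd length has one
-- more edge of one colour.  Conversely, two disjoint matchings alternate along every component of
-- H ∪ H′, whose components (with the uncovered vertices as trivial paths) form a pec decomposition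
-- G′ with p(G′) = n − |H| − |H′| and |H| − |H′| ≤ p(G′) − e(G′).  Applying the first construction
-- to optimal decompositions and the second to optimal pairs of matchings gives λ + p = n and
-- 2μ + e_p = λ + p, which rearrange to the two identities.
module Submission where

open import Defs
open import Data.Fin.Subset using (Subset)

module ListLemmas where

  open import Data.Empty using (⊥; ⊥-elim)
  open import Data.Fin using (Fin; zero; suc)
  open import Data.Product using (Σ; _,_)
  open import Data.List using (List; []; _∷_; _++_; concatMap; lookup)
  import Data.List as L
  open import Data.List.Properties using (map-tabulate)
  open import Data.List.Membership.Propositional using (_∈_; _∉_; find; lose)
  open import Data.List.Membership.Propositional.Properties using (∈-++⁺ˡ; ∈-++⁺ʳ; ∈-∃++; ∈-concatMap⁺; ∈-concatMap⁻)
  open import Data.List.Relation.Unary.Any as Any using (here; there)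
  open import Data.List.Relation.Unary.Any.Properties using (lookup-index)
  open import Data.List.Relation.Unary.All.Properties as All using (¬Any⇒All¬)
  import Data.List.Relation.Unary.AllPairs.Properties as AllPairs
  open import Data.List.Relation.Unary.Unique.Propositional as U using (Unique; []; _∷_)
  open import Data.List.Relation.Unary.Unique.Propositional.Properties using (Unique[x∷xs]⇒x∉xs; concat⁺; ++⁺)
  open import Data.List.Relation.Binary.Permutation.Propositional using (_↭_; refl; prep; swap; trans; ↭⇒↭ₛ)
  open import Data.List.Relation.Binary.Permutation.Propositional.Properties using (shift; shifts; ++⁺ˡ)
  import Data.List.Relation.Binary.Permutation.Setoid.Properties as ↭ₛ
  open import Relation.Binary.PropositionalEquality using (_≡_; _≢_; refl; sym; cong; subst; setoid) renaming (trans to ≡-trans)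

  private
    variable
      A B : Set
      x y : A
      xs ys : List A

  unique-∷ : x ∉ xs → Unique xs → Unique (x ∷ xs)
  unique-∷ x∉xs u = ¬Any⇒All¬ _ x∉xs ∷ u

  Unique-resp-↭ : xs ↭ ys → Unique xs → Unique ys
  Unique-resp-↭ p = ↭ₛ.Unique-resp-↭ (setoid _) (↭⇒↭ₛ p)

  unique-++ˡ : ∀ (xs : List A) → Unique (xs ++ ys) → Unique xs
  unique-++ˡ []       _ = []
  unique-++ˡ (x ∷ xs) u =
    unique-∷ (λ x∈xs → Unique[x∷xs]⇒x∉xs u (∈-++⁺ˡ x∈xs)) (unique-++ˡ xs (U.tail u))

  unique-++ʳ : ∀ (xs : List A) → Unique (xs ++ ys) → Unique ys
  unique-++ʳ []       u = u
  unique-++ʳ (x ∷ xs) u = unique-++ʳ xs (U.tail u)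

  unique-++-disjoint : ∀ (xs : List A) → Unique (xs ++ ys) → x ∈ xs → x ∈ ys → ⊥
  unique-++-disjoint (x ∷ xs) u (here refl) x∈ys = Unique[x∷xs]⇒x∉xs u (∈-++⁺ʳ xs x∈ys)
  unique-++-disjoint (x ∷ xs) u (there z∈xs) z∈ys = unique-++-disjoint xs (U.tail u) z∈xs z∈ys

  ∈⇒↭∷ : x ∈ xs → Σ (List A) λ ys → xs ↭ x ∷ ys
  ∈⇒↭∷ {x = x} x∈xs with ∈-∃++ x∈xs
  ... | ys , zs , refl = ys ++ zs , shift x ys zs

  drop-head : (x ≡ y → ⊥) → x ∈ y ∷ ys → x ∈ ys
  drop-head x≢y (here x≡y) = ⊥-elim (x≢y x≡y)
  drop-head _   (there x∈ys) = x∈ys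

  last⁺ : A → List A → A
  last⁺ x []       = x
  last⁺ x (y ∷ ys) = last⁺ y ys

  last⁺∈ : ∀ (x : A) xs → last⁺ x xs ∈ x ∷ xs
  last⁺∈ x []       = here refl
  last⁺∈ x (y ∷ ys) = there (last⁺∈ y ys)

  concatMap-↭ : ∀ (f : A → List B) → xs ↭ ys → concatMap f xs ↭ concatMap f ys
  concatMap-↭ f refl         = refl
  concatMap-↭ f (prep x p)   = ++⁺ˡ (f x) (concatMap-↭ f p)
  concatMap-↭ f (swap x y p) = trans (shifts (f x) (f y)) (++⁺ˡ (f y) (++⁺ˡ (f x) (concatMap-↭ f p)))
  concatMap-↭ f (trans p q)  = trans (concatMap-↭ f p) (concatMap-↭ f q)

  unique-concatMap-∈ : ∀ (f : A → List B) → Unique (concatMap f xs) → x ∈ xs → Unique (f x)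
  unique-concatMap-∈ {xs = x ∷ xs} f u (here refl) = unique-++ˡ (f x) u
  unique-concatMap-∈ {xs = x ∷ xs} f u (there x∈) = unique-concatMap-∈ f (unique-++ʳ (f x) u) x∈

  ∈-concatMap-lookup : ∀ (f : A → List B) xs i {z} → z ∈ f (lookup xs i) → z ∈ concatMap f xs
  ∈-concatMap-lookup f (x ∷ xs) zero    z∈ = ∈-++⁺ˡ z∈
  ∈-concatMap-lookup f (x ∷ xs) (suc i) z∈ = ∈-++⁺ʳ (f x) (∈-concatMap-lookup f xs i z∈)

  concatMap-unique-index : ∀ (f : A → List B) xs → Unique (concatMap f xs) →
    ∀ {z} i j → z ∈ f (lookup xs i) → z ∈ f (lookup xs j) → i ≡ j
  concatMap-unique-index f (x ∷ xs) u zero    zero    _   _   = refl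
  concatMap-unique-index f (x ∷ xs) u zero    (suc j) z∈i z∈j =
    ⊥-elim (unique-++-disjoint (f x) u z∈i (∈-concatMap-lookup f xs j z∈j))
  concatMap-unique-index f (x ∷ xs) u (suc i) zero    z∈i z∈j =
    ⊥-elim (unique-++-disjoint (f x) u z∈j (∈-concatMap-lookup f xs i z∈i))
  concatMap-unique-index f (x ∷ xs) u (suc i) (suc j) z∈i z∈j =
    cong suc (concatMap-unique-index f xs (unique-++ʳ (f x) u) i j z∈i z∈j)

  concatMap-unique-∈ : ∀ (f : A → List B) → Unique (concatMap f xs) →
    ∀ {z} → (x∈ : x ∈ xs) (y∈ : y ∈ xs) → z ∈ f x → z ∈ f y → x ≡ y
  concatMap-unique-∈ {xs = xs} f u x∈ y∈ z∈x z∈y =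
    ≡-trans (lookup-index x∈)
      (≡-trans (cong (lookup xs) (concatMap-unique-index f xs u (Any.index x∈) (Any.index y∈)
                                    (subst (λ v → _ ∈ f v) (lookup-index x∈) z∈x)
                                    (subst (λ v → _ ∈ f v) (lookup-index y∈) z∈y)))
               (sym (lookup-index y∈)))

  unique-concatMap-tabulate : ∀ {k} (f : A → List B) (F : Fin k → A) → (∀ i → Unique (f (F i))) →
    (∀ {i j z} → i ≢ j → z ∈ f (F i) → z ∈ f (F j) → ⊥) → Unique (concatMap f (L.tabulate F))
  unique-concatMap-tabulate f F unique disjoint =
    subst (λ xss → Unique (L.concat xss)) (sym (map-tabulate F f))
      (concat⁺ (All.tabulate⁺ unique) (AllPairs.tabulate⁺ (λ i≢j (z∈i , z∈j) → disjoint i≢j z∈i z∈j)))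

  unique-concatMap-anchored : ∀ {C : Set} (f : A → List B) (s : A → List C) (π : C → B) →
    Unique (concatMap f xs) → (∀ x → x ∈ xs → Unique (s x)) → (∀ x {z} → z ∈ s x → π z ∈ f x) →
    Unique (concatMap s xs)
  unique-concatMap-anchored {xs = []}     f s π _ _ _ = []
  unique-concatMap-anchored {xs = x ∷ xs} f s π u us anchor =
    ++⁺ (us x (here refl)) (unique-concatMap-anchored f s π (unique-++ʳ (f x) u) (λ y y∈ → us y (there y∈)) anchor)
      (λ (z∈sx , z∈rest) → let y , y∈xs , z∈sy = find (∈-concatMap⁻ s {xs = xs} z∈rest) in
         unique-++-disjoint (f x) u (anchor x z∈sx) (∈-concatMap⁺ f {xs = xs} (lose y∈xs (anchor y z∈sy))))

module Counting where

  open ListLemmas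
  open import Data.Nat using (ℕ; zero; suc; _+_)
  open import Data.Nat.Properties using (+-assoc; +-comm; +-suc)
  open import Data.Bool using (Bool; true; false; not)
  open import Data.Empty using (⊥; ⊥-elim)
  open import Data.Fin using (Fin; zero; suc; _≟_)
  open import Data.Fin.Subset using (Subset; ∣_∣) renaming (_∈_ to _∈ₛ_)
  import Data.Vec as V
  open import Data.Vec.Properties using (tabulate∘lookup; lookup∘tabulate; lookup⇒[]=; []=⇒lookup)
  open import Data.Product using (_,_)
  open import Relation.Nullary using (yes; no; does)
  open import Data.List using (List; []; _∷_; _++_; length)
  import Data.List as L
  open import Data.List.Membership.Propositional using (_∈_; _∉_)
  open import Data.List.Membership.Propositional.Properties using (∈-allFin)
  open import Data.List.Relation.Unary.Any using (here; there)
  open import Data.List.Relation.Unary.Unique.Propositional as U using (Unique)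
  open import Data.List.Relation.Unary.Unique.Propositional.Properties using (Unique[x∷xs]⇒x∉xs; allFin⁺)
  open import Data.List.Relation.Binary.Permutation.Propositional using (_↭_; refl; prep; swap; trans; ↭-sym)
  open import Data.List.Relation.Binary.Permutation.Propositional.Properties using (∈-resp-↭)
  open import Relation.Binary.PropositionalEquality using (_≡_; refl; sym; cong; cong₂; module ≡-Reasoning) renaming (trans to ≡-trans)

  private
    variable
      A : Set
      x : A
      xs ys : List A

  bit : Bool → ℕ
  bit true  = 1
  bit false = 0

  countᵇ : (A → Bool) → List A → ℕ
  countᵇ g []       = 0
  countᵇ g (x ∷ xs) = bit (g x) + countᵇ g xs

  countᵇ-++ : ∀ (g : A → Bool) xs ys → countᵇ g (xs ++ ys) ≡ countᵇ g xs + countᵇ g ys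
  countᵇ-++ g []       ys = refl
  countᵇ-++ g (x ∷ xs) ys = ≡-trans (cong (bit (g x) +_) (countᵇ-++ g xs ys)) (sym (+-assoc (bit (g x)) _ _))

  countᵇ-resp-↭ : ∀ (g : A → Bool) → xs ↭ ys → countᵇ g xs ≡ countᵇ g ys
  countᵇ-resp-↭ g refl         = refl
  countᵇ-resp-↭ g (prep x p)   = cong (bit (g x) +_) (countᵇ-resp-↭ g p)
  countᵇ-resp-↭ g (swap {xs} {ys} x y p) = begin
    bit (g x) + (bit (g y) + countᵇ g xs) ≡⟨ sym (+-assoc (bit (g x)) _ _) ⟩
    bit (g x) + bit (g y) + countᵇ g xs   ≡⟨ cong (_+ countᵇ g xs) (+-comm (bit (g x)) _) ⟩
    bit (g y) + bit (g x) + countᵇ g xs   ≡⟨ +-assoc (bit (g y)) _ _ ⟩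
    bit (g y) + (bit (g x) + countᵇ g xs) ≡⟨ cong (λ k → bit (g y) + (bit (g x) + k)) (countᵇ-resp-↭ g p) ⟩
    bit (g y) + (bit (g x) + countᵇ g ys) ∎
    where open ≡-Reasoning
  countᵇ-resp-↭ g (trans p q)  = ≡-trans (countᵇ-resp-↭ g p) (countᵇ-resp-↭ g q)

  countᵇ-unique-≡ : ∀ (g : A → Bool) → Unique xs → Unique ys →
    (∀ z → g z ≡ true → z ∈ xs → z ∈ ys) → (∀ z → g z ≡ true → z ∈ ys → z ∈ xs) →
    countᵇ g xs ≡ countᵇ g ys
  countᵇ-unique-≡ {xs = []} g _ _ _ ys⊆xs = sym (none-true _ (λ z gz z∈ys → ∉[] (ys⊆xs z gz z∈ys)))
    where
      ∉[] : ∀ {z : A} → z ∉ []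
      ∉[] ()
      none-true : ∀ ys → (∀ z → g z ≡ true → z ∉ ys) → countᵇ g ys ≡ 0
      none-true []       _ = refl
      none-true (y ∷ ys) h with g y in gy
      ... | true  = ⊥-elim (h y gy (here refl))
      ... | false = none-true ys (λ z gz z∈ys → h z gz (there z∈ys))
  countᵇ-unique-≡ {xs = x ∷ xs} {ys} g ux uy xs⊆ys ys⊆xs with g x in gx
  ... | false = countᵇ-unique-≡ g (U.tail ux) uy (λ z gz z∈xs → xs⊆ys z gz (there z∈xs))
                  (λ z gz z∈ys → drop-head (λ { refl → true≢false gz gx }) (ys⊆xs z gz z∈ys))
    where
      true≢false : ∀ {b} → b ≡ true → b ≡ false → ⊥
      true≢false refl ()
  ... | true with ∈⇒↭∷ (xs⊆ys x gx (here refl))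
  ...   | ys′ , ys↭x∷ys′ = begin
    suc (countᵇ g xs)   ≡⟨ cong suc rec ⟩
    suc (countᵇ g ys′)  ≡⟨ cong (λ b → bit b + countᵇ g ys′) gx ⟨
    countᵇ g (x ∷ ys′)  ≡⟨ countᵇ-resp-↭ g ys↭x∷ys′ ⟨
    countᵇ g ys         ∎
    where
      open ≡-Reasoning
      ux∷ys′ : Unique (x ∷ ys′)
      ux∷ys′ = Unique-resp-↭ ys↭x∷ys′ uy
      rec : countᵇ g xs ≡ countᵇ g ys′
      rec = countᵇ-unique-≡ g (U.tail ux) (U.tail ux∷ys′)
        (λ z gz z∈xs → drop-head (λ { refl → Unique[x∷xs]⇒x∉xs ux z∈xs })
                                 (∈-resp-↭ ys↭x∷ys′ (xs⊆ys z gz (there z∈xs))))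
        (λ z gz z∈ys′ → drop-head (λ { refl → Unique[x∷xs]⇒x∉xs ux∷ys′ z∈ys′ })
                                  (ys⊆xs z gz (∈-resp-↭ (↭-sym ys↭x∷ys′) (there z∈ys′))))

  countᵇ-true : ∀ (g : A → Bool) xs → (∀ x → x ∈ xs → g x ≡ true) → countᵇ g xs ≡ length xs
  countᵇ-true g []       _   = refl
  countᵇ-true g (x ∷ xs) all rewrite all x (here refl) = cong suc (countᵇ-true g xs (λ z z∈xs → all z (there z∈xs)))

  countᵇ-+-not : ∀ (g : A → Bool) xs → countᵇ g xs + countᵇ (λ x → not (g x)) xs ≡ length xs
  countᵇ-+-not g []       = refl
  countᵇ-+-not g (x ∷ xs) with g x
  ... | true  = cong suc (countᵇ-+-not g xs)
  ... | false = ≡-trans (+-suc _ _) (cong suc (countᵇ-+-not g xs))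

  countᵇ-cong : ∀ (g h : A → Bool) xs → (∀ x → x ∈ xs → g x ≡ h x) → countᵇ g xs ≡ countᵇ h xs
  countᵇ-cong g h []       _  = refl
  countᵇ-cong g h (x ∷ xs) eq = cong₂ _+_ (cong bit (eq x (here refl))) (countᵇ-cong g h xs (λ z z∈xs → eq z (there z∈xs)))

  length-unique-≡ : Unique xs → Unique ys → (∀ z → z ∈ xs → z ∈ ys) → (∀ z → z ∈ ys → z ∈ xs) →
                    length xs ≡ length ys
  length-unique-≡ {xs = xs} {ys} ux uy xs⊆ys ys⊆xs = begin
    length xs         ≡⟨ countᵇ-true always xs (λ _ _ → refl) ⟨
    countᵇ always xs  ≡⟨ countᵇ-unique-≡ always ux uy (λ z _ → xs⊆ys z) (λ z _ → ys⊆xs z) ⟩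
    countᵇ always ys  ≡⟨ countᵇ-true always ys (λ _ _ → refl) ⟩
    length ys         ∎
    where
      open ≡-Reasoning
      always : _ → Bool
      always _ = true

  ∣tabulate∣≡countᵇ : ∀ {k} (f : Fin k → A) (h : Fin k → Bool) (g : A → Bool) →
    (∀ i → h i ≡ g (f i)) → ∣ V.tabulate h ∣ ≡ countᵇ g (L.tabulate f)
  ∣tabulate∣≡countᵇ {k = zero}  f h g eq = refl
  ∣tabulate∣≡countᵇ {k = suc k} f h g eq =
    ≡-trans (∣∷∣ (h zero) (V.tabulate (λ i → h (suc i))))
      (cong₂ _+_ (cong bit (eq zero)) (∣tabulate∣≡countᵇ (λ i → f (suc i)) (λ i → h (suc i)) g (λ i → eq (suc i))))
    where
      ∣∷∣ : ∀ {k} b (p : Subset k) → ∣ b V.∷ p ∣ ≡ bit b + ∣ p ∣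
      ∣∷∣ true  p = refl
      ∣∷∣ false p = refl

  module _ {m : ℕ} where
    open import Data.List.Membership.DecPropositional (_≟_ {m}) using (_∈?_)

    ∣S∣≡countᵇ : ∀ (S : Subset m) {xs} → Unique xs → (∀ e → e ∈ₛ S → e ∈ xs) →
                 ∣ S ∣ ≡ countᵇ (V.lookup S) xs
    ∣S∣≡countᵇ S {xs} u S⊆xs = begin
      ∣ S ∣                             ≡⟨ cong ∣_∣ (tabulate∘lookup S) ⟨
      ∣ V.tabulate (V.lookup S) ∣       ≡⟨ ∣tabulate∣≡countᵇ (λ e → e) (V.lookup S) (V.lookup S) (λ _ → refl) ⟩
      countᵇ (V.lookup S) (L.allFin m)  ≡⟨ countᵇ-unique-≡ (V.lookup S) (allFin⁺ m) u
                                             (λ e e∈S _ → S⊆xs e (lookup⇒[]= e S e∈S)) (λ e _ _ → ∈-allFin e) ⟩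
      countᵇ (V.lookup S) xs            ∎
      where open ≡-Reasoning

    toSubset : List (Fin m) → Subset m
    toSubset xs = V.tabulate (λ e → does (e ∈? xs))

    lookup-toSubset : ∀ xs e → e ∈ xs → V.lookup (toSubset xs) e ≡ true
    lookup-toSubset xs e e∈xs rewrite lookup∘tabulate (λ e → does (e ∈? xs)) e with e ∈? xs
    ... | yes _    = refl
    ... | no e∉xs = ⊥-elim (e∉xs e∈xs)

    ∈-toSubset⁻ : ∀ xs {e} → e ∈ₛ toSubset xs → e ∈ xs
    ∈-toSubset⁻ xs {e} e∈S
      with e ∈? xs | ≡-trans (sym (lookup∘tabulate (λ e → does (e ∈? xs)) e)) ([]=⇒lookup e∈S)
    ... | yes e∈xs | _ = e∈xs
    ... | no _     | ()

    ∣toSubset∣ : ∀ {xs} → Unique xs → ∣ toSubset xs ∣ ≡ length xs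
    ∣toSubset∣ {xs} u = ≡-trans (∣S∣≡countᵇ (toSubset xs) u (λ e → ∈-toSubset⁻ xs))
                                 (countᵇ-true _ xs (lookup-toSubset xs))

module Parity where

  open ListLemmas using (unique-∷)
  open Counting using (bit)
  open import Data.Nat using (ℕ; zero; suc; _+_; _%_; _≡ᵇ_)
  open import Data.Nat.Properties using (+-assoc; +-comm)
  open import Data.Bool using (Bool; true; false; not)
  open import Data.Bool.Properties using (not-involutive)
  open import Data.Empty using (⊥)
  open import Data.List using (List; []; _∷_; length)
  open import Data.List.Membership.Propositional using (_∈_)
  open import Data.List.Relation.Unary.Any using (here; there)
  open import Data.List.Relation.Unary.Unique.Propositional as U using (Unique; [])
  open import Data.List.Relation.Unary.Unique.Propositional.Properties using (Unique[x∷xs]⇒x∉xs)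
  open import Relation.Binary.PropositionalEquality using (_≡_; refl; sym; trans; cong; module ≡-Reasoning)

  private
    variable
      A : Set
      x : A
      xs : List A

  isEven : ℕ → Bool
  isEven k = k % 2 ≡ᵇ 0

  isEven-suc : ∀ k → isEven (suc k) ≡ not (isEven k)
  isEven-suc zero          = refl
  isEven-suc (suc zero)    = refl
  isEven-suc (suc (suc k)) = isEven-suc k

  isEven-pred : ∀ k {b} → isEven (suc k) ≡ b → isEven k ≡ not b
  isEven-pred k eq = trans (sym (not-involutive (isEven k))) (cong not (trans (sym (isEven-suc k)) eq))

  %2≡0⇒isEven : ∀ k → k % 2 ≡ 0 → isEven k ≡ true
  %2≡0⇒isEven k = cong (_≡ᵇ 0)

  suc%2≡0⇒odd : ∀ k → suc k % 2 ≡ 0 → isEven k ≡ false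
  suc%2≡0⇒odd k even = isEven-pred k (%2≡0⇒isEven (suc k) even)

  isEven⇒%2≡0 : ∀ k → isEven k ≡ true → k % 2 ≡ 0
  isEven⇒%2≡0 k = ≡ᵇ0⇒≡0 (k % 2)
    where
      ≡ᵇ0⇒≡0 : ∀ r → (r ≡ᵇ 0) ≡ true → r ≡ 0
      ≡ᵇ0⇒≡0 zero    _ = refl
      ≡ᵇ0⇒≡0 (suc r) ()

  oddBit : ℕ → ℕ
  oddBit k = bit (not (isEven k))

  oddBit+evenBit≡1 : ∀ k → oddBit k + bit (isEven k) ≡ 1
  oddBit+evenBit≡1 k with isEven k
  ... | true  = refl
  ... | false = refl

  suc≡+oddBit+oddBit : ∀ h k → suc h ≡ h + oddBit k + oddBit (suc k)
  suc≡+oddBit+oddBit h k = begin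
    suc h                              ≡⟨ +-comm 1 h ⟩
    h + 1                              ≡⟨ cong (h +_) (oddBit+oddBit-suc k) ⟨
    h + (oddBit k + oddBit (suc k))    ≡⟨ +-assoc h _ _ ⟨
    h + oddBit k + oddBit (suc k)      ∎
    where
      open ≡-Reasoning
      oddBit+oddBit-suc : ∀ k → oddBit k + oddBit (suc k) ≡ 1
      oddBit+oddBit-suc k rewrite isEven-suc k with isEven k
      ... | true  = refl
      ... | false = refl

  evens odds : List A → List A
  evens []       = []
  evens (x ∷ xs) = x ∷ odds xs
  odds []       = []
  odds (x ∷ xs) = evens xs

  evens-⊆ : ∀ (xs : List A) → x ∈ evens xs → x ∈ xs
  odds-⊆  : ∀ (xs : List A) → x ∈ odds xs → x ∈ xs
  evens-⊆ (y ∷ ys) (here x≡y)  = here x≡y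
  evens-⊆ (y ∷ ys) (there x∈) = there (odds-⊆ ys x∈)
  odds-⊆  (y ∷ ys) x∈          = there (evens-⊆ ys x∈)

  evens⁺ : ∀ (xs : List A) → Unique xs → Unique (evens xs)
  odds⁺  : ∀ (xs : List A) → Unique xs → Unique (odds xs)
  evens⁺ []       _ = []
  evens⁺ (x ∷ xs) u = unique-∷ (λ x∈ → Unique[x∷xs]⇒x∉xs u (odds-⊆ xs x∈)) (odds⁺ xs (U.tail u))
  odds⁺  []       _ = []
  odds⁺  (x ∷ xs) u = evens⁺ xs (U.tail u)

  evens-odds-disjoint : ∀ (xs : List A) → Unique xs → x ∈ evens xs → x ∈ odds xs → ⊥
  evens-odds-disjoint (y ∷ ys) u (here refl) x∈odds = Unique[x∷xs]⇒x∉xs u (evens-⊆ ys x∈odds)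
  evens-odds-disjoint (y ∷ ys) u (there x∈odds) x∈evens = evens-odds-disjoint ys (U.tail u) x∈evens x∈odds

  length-evens : ∀ (xs : List A) → length (evens xs) ≡ length (odds xs) + oddBit (length xs)
  length-evens []       = refl
  length-evens (x ∷ xs) rewrite length-evens xs = suc≡+oddBit+oddBit (length (odds xs)) (length xs)

  length-evens+odds : ∀ (xs : List A) → length (evens xs) + length (odds xs) ≡ length xs
  length-evens+odds []       = refl
  length-evens+odds (x ∷ xs) = cong suc (trans (+-comm (length (odds xs)) _) (length-evens+odds xs))

module Walks (G : Graph) where

  open ListLemmas using (last⁺)
  open import Data.Nat using (zero; suc)
  open import Data.Empty using (⊥-elim)
  open import Data.Fin using (Fin; zero; suc; inject₁; fromℕ)
  open import Data.Product using (Σ; _×_; _,_)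
  open import Data.Sum using (_⊎_; inj₁; inj₂)
  open import Data.List using (List; []; _∷_; _++_; length; reverse)
  import Data.List as L
  open import Data.List.Properties using (unfold-reverse)
  open import Data.List.Membership.Propositional using (_∈_)
  open import Data.List.Relation.Unary.Any using (here; there)
  open import Data.List.Relation.Unary.Unique.Propositional as U using (Unique)
  open import Data.List.Relation.Unary.Unique.Propositional.Properties using (Unique[x∷xs]⇒x∉xs)
  open import Relation.Binary.PropositionalEquality using (_≡_; _≢_; refl; sym; cong; subst; subst₂)

  Joins-sym : ∀ {e u v} → Joins G e u v → Joins G e v u
  Joins-sym (inj₁ eq) = inj₂ eq
  Joins-sym (inj₂ eq) = inj₁ eq

  Joins⇒Incidentˡ : ∀ {e u v} → Joins G e u v → Incident G u e
  Joins⇒Incidentˡ (inj₁ eq) rewrite eq = inj₁ refl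
  Joins⇒Incidentˡ (inj₂ eq) rewrite eq = inj₂ refl

  Joins⇒Incidentʳ : ∀ {e u v} → Joins G e u v → Incident G v e
  Joins⇒Incidentʳ j = Joins⇒Incidentˡ (Joins-sym j)

  Incident-Joins : ∀ {e u v w} → Joins G e u v → Incident G w e → w ≡ u ⊎ w ≡ v
  Incident-Joins (inj₁ eq) (inj₁ w≡) rewrite eq = inj₁ w≡
  Incident-Joins (inj₁ eq) (inj₂ w≡) rewrite eq = inj₂ w≡
  Incident-Joins (inj₂ eq) (inj₁ w≡) rewrite eq = inj₂ w≡
  Incident-Joins (inj₂ eq) (inj₂ w≡) rewrite eq = inj₁ w≡

  data Walk : Vtx G → Vtx G → List (Vtx G) → List (Edg G) → Set where
    stop : ∀ v → Walk v v (v ∷ []) []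
    step : ∀ {u v w vs es} e → Joins G e u v → Walk v w vs es → Walk u w (u ∷ vs) (e ∷ es)

  private
    variable
      a b c d : Vtx G
      vs ws : List (Vtx G)
      es fs : List (Edg G)

  length-vertices : Walk a b vs es → length vs ≡ suc (length es)
  length-vertices (stop v)     = refl
  length-vertices (step e j w) = cong suc (length-vertices w)

  start∈ : Walk a b vs es → a ∈ vs
  start∈ (stop v)     = here refl
  start∈ (step e j w) = here refl

  end∈ : Walk a b vs es → b ∈ vs
  end∈ (stop v)     = here refl
  end∈ (step e j w) = there (end∈ w)

  endpoint∈ : ∀ {e w} → Walk a b vs es → e ∈ es → Incident G w e → w ∈ vs
  endpoint∈ (step e j p) (here refl) w∈e with Incident-Joins j w∈e
  ... | inj₁ refl = here refl
  ... | inj₂ refl = there (start∈ p)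
  endpoint∈ (step e j p) (there e∈es) w∈e = there (endpoint∈ p e∈es w∈e)

  connect : ∀ e → Walk a b vs es → Joins G e b c → Walk c d ws fs → Walk a d (vs ++ ws) (es ++ e ∷ fs)
  connect e (stop v)       j w₂ = step e j w₂
  connect e (step e′ j′ w) j w₂ = step e′ j′ (connect e w j w₂)

  reverse-walk : Walk a b vs es → Walk b a (reverse vs) (reverse es)
  reverse-walk (stop v) = stop v
  reverse-walk {a} {b} (step {vs = vs} {es} e j w) =
    subst₂ (Walk b a) (sym (unfold-reverse a vs)) (sym (unfold-reverse e es))
      (connect e (reverse-walk w) (Joins-sym j) (stop a))

  start-incident : ∀ {e} → Walk a b vs (e ∷ es) → Incident G a e
  start-incident (step e j w) = Joins⇒Incidentˡ j

  end-incident : ∀ {e} → Walk a b vs (e ∷ es) → Incident G b (last⁺ e es)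
  end-incident (step e j (stop v))        = Joins⇒Incidentʳ j
  end-incident (step e j (step e′ j′ w)) = end-incident (step e′ j′ w)

  InnerVertex : Vtx G → List (Edg G) → Set
  InnerVertex u es = Σ (Edg G) λ e₁ → Σ (Edg G) λ e₂ →
    e₁ ∈ es × e₂ ∈ es × e₁ ≢ e₂ × Incident G u e₁ × Incident G u e₂

  ∈-walk⇒end⊎inner : ∀ {u} → Walk a b vs es → Unique es → u ∈ vs → u ≡ a ⊎ u ≡ b ⊎ InnerVertex u es
  ∈-walk⇒end⊎inner (stop v)     _ (here eq) = inj₁ eq
  ∈-walk⇒end⊎inner (step e j w) _ (here eq) = inj₁ eq
  ∈-walk⇒end⊎inner (step e j w) ue (there u∈) with ∈-walk⇒end⊎inner w (U.tail ue) u∈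
  ... | inj₂ (inj₁ eq) = inj₂ (inj₁ eq)
  ... | inj₂ (inj₂ (e₁ , e₂ , e₁∈ , e₂∈ , e₁≢e₂ , u∈e₁ , u∈e₂)) =
    inj₂ (inj₂ (e₁ , e₂ , there e₁∈ , there e₂∈ , e₁≢e₂ , u∈e₁ , u∈e₂))
  ... | inj₁ refl with w
  ...   | stop _         = inj₂ (inj₁ refl)
  ...   | step e′ j′ w′ = inj₂ (inj₂ (e , e′ , here refl , there (here refl) ,
                            (λ e≡e′ → Unique[x∷xs]⇒x∉xs ue (here e≡e′)) , Joins⇒Incidentʳ j , Joins⇒Incidentˡ j′))

  vertexAt : Walk a b vs es → Fin (suc (length es)) → Vtx G
  vertexAt (stop v)            zero    = v
  vertexAt (step {u = u} e j w) zero    = u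
  vertexAt (step e j w)         (suc i) = vertexAt w i

  edgeAt : Walk a b vs es → Fin (length es) → Edg G
  edgeAt (step e j w) zero    = e
  edgeAt (step e j w) (suc i) = edgeAt w i

  vertexAt-zero : (w : Walk a b vs es) → vertexAt w zero ≡ a
  vertexAt-zero (stop v)     = refl
  vertexAt-zero (step e j w) = refl

  vertexAt-last : (w : Walk a b vs es) → vertexAt w (fromℕ (length es)) ≡ b
  vertexAt-last (stop v)     = refl
  vertexAt-last (step e j w) = vertexAt-last w

  vertexAt∈ : (w : Walk a b vs es) → ∀ i → vertexAt w i ∈ vs
  vertexAt∈ (stop v)     zero    = here refl
  vertexAt∈ (step e j w) zero    = here refl
  vertexAt∈ (step e j w) (suc i) = there (vertexAt∈ w i)

  edgeAt∈ : (w : Walk a b vs es) → ∀ i → edgeAt w i ∈ es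
  edgeAt∈ (step e j w) zero    = here refl
  edgeAt∈ (step e j w) (suc i) = there (edgeAt∈ w i)

  ∈⇒vertexAt : ∀ {u} (w : Walk a b vs es) → u ∈ vs → Σ (Fin (suc (length es))) λ i → vertexAt w i ≡ u
  ∈⇒vertexAt (stop v)     (here refl) = zero , refl
  ∈⇒vertexAt (step e j w) (here refl) = zero , refl
  ∈⇒vertexAt (step e j w) (there u∈)  with ∈⇒vertexAt w u∈
  ... | i , eq = suc i , eq

  vertexAt-injective : (w : Walk a b vs es) → Unique vs → ∀ {i k} → vertexAt w i ≡ vertexAt w k → i ≡ k
  vertexAt-injective (stop v)     _  {zero}  {zero}  _  = refl
  vertexAt-injective (step e j w) _  {zero}  {zero}  _  = refl
  vertexAt-injective (step e j w) uv {zero}  {suc k} eq =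
    ⊥-elim (Unique[x∷xs]⇒x∉xs uv (subst (_∈ _) (sym eq) (vertexAt∈ w k)))
  vertexAt-injective (step e j w) uv {suc i} {zero}  eq =
    ⊥-elim (Unique[x∷xs]⇒x∉xs uv (subst (_∈ _) eq (vertexAt∈ w i)))
  vertexAt-injective (step e j w) uv {suc i} {suc k} eq = cong suc (vertexAt-injective w (U.tail uv) eq)

  edgeAt-injective : (w : Walk a b vs es) → Unique es → ∀ {i k} → edgeAt w i ≡ edgeAt w k → i ≡ k
  edgeAt-injective (step e j w) _  {zero}  {zero}  _  = refl
  edgeAt-injective (step e j w) ue {zero}  {suc k} eq =
    ⊥-elim (Unique[x∷xs]⇒x∉xs ue (subst (_∈ _) (sym eq) (edgeAt∈ w k)))
  edgeAt-injective (step e j w) ue {suc i} {zero}  eq =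
    ⊥-elim (Unique[x∷xs]⇒x∉xs ue (subst (_∈ _) eq (edgeAt∈ w i)))
  edgeAt-injective (step e j w) ue {suc i} {suc k} eq = cong suc (edgeAt-injective w (U.tail ue) eq)

  edgeAt-joins : (w : Walk a b vs es) → ∀ i → Joins G (edgeAt w i) (vertexAt w (inject₁ i)) (vertexAt w (suc i))
  edgeAt-joins (step e j w) zero    = subst (Joins G e _) (sym (vertexAt-zero w)) j
  edgeAt-joins (step e j w) (suc i) = edgeAt-joins w i

  toPathData : Walk a b vs es → Unique vs → Unique es → PathData G
  toPathData {es = es} w uv ue = record
    { len    = length es
    ; vs     = vertexAt w
    ; es     = edgeAt w
    ; vs-inj = vertexAt-injective w uv
    ; es-inj = edgeAt-injective w ue
    ; joins  = edgeAt-joins w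
    }

  tabulate-walk : ∀ k (vs : Fin (suc k) → Vtx G) (es : Fin k → Edg G) →
    (∀ i → Joins G (es i) (vs (inject₁ i)) (vs (suc i))) →
    Walk (vs zero) (vs (fromℕ k)) (L.tabulate vs) (L.tabulate es)
  tabulate-walk zero    vs es j = stop (vs zero)
  tabulate-walk (suc k) vs es j =
    step (es zero) (j zero) (tabulate-walk k (λ i → vs (suc i)) (λ i → es (suc i)) (λ i → j (suc i)))

  pathWalk : (P : PathData G) →
    Walk (PathData.vs P zero) (PathData.vs P (fromℕ (PathData.len P)))
         (L.tabulate (PathData.vs P)) (L.tabulate (PathData.es P))
  pathWalk P = tabulate-walk (PathData.len P) (PathData.vs P) (PathData.es P) (PathData.joins P)

module Decompositions (G : Graph) where

  open ListLemmas
  open Counting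
  open Parity
  open Walks G
  open import Data.Nat using (zero; suc; _+_; _≤_; _%_)
  open import Data.Nat.Properties using (+-comm; +-identityʳ; +-commutativeSemigroup)
  open import Algebra.Properties.CommutativeSemigroup +-commutativeSemigroup using (interchange)
  open import Data.Bool using (Bool; true; false)
  open import Data.Empty using (⊥)
  open import Data.Fin using (Fin)
  open import Data.Product using (Σ; _×_; _,_)
  open import Data.Sum using (inj₁; inj₂)
  open import Data.List using (List; []; _∷_; _++_; length; concatMap; lookup)
  import Data.List as L
  open import Data.List.Properties using (length-++; length-tabulate; tabulate-lookup)
  open import Data.List.Membership.Propositional using (_∈_; find)
  open import Data.List.Membership.Propositional.Properties using (∈-lookup; ∈-concatMap⁺; ∈-concatMap⁻; ∈-allFin; ∈-tabulate⁺; ∈-tabulate⁻)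
  open import Data.List.Relation.Unary.Any as Any using (here; there)
  open import Data.List.Relation.Unary.Any.Properties as Any using (lookup-index)
  open import Data.List.Relation.Unary.Unique.Propositional as U using (Unique)
  open import Data.List.Relation.Unary.Unique.Propositional.Properties using (Unique[x∷xs]⇒x∉xs; allFin⁺; tabulate⁺)
  open import Data.List.Relation.Binary.Permutation.Propositional using (_↭_)
  open import Data.List.Relation.Binary.Permutation.Propositional.Properties using (∈-resp-↭)
  open import Relation.Binary.PropositionalEquality using (_≡_; _≢_; refl; sym; trans; cong; cong₂; subst; subst₂; module ≡-Reasoning)

  private
    variable
      a b : Vtx G
      vs : List (Vtx G)
      es : List (Edg G)

  -- A Component presented by a Walk, so that its vertices and edges are lists that can be merged and permuted.
  data WalkComponent : Set where
    pathᵂ  : Walk a b vs es → WalkComponent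
    cycleᵂ : Walk a b vs es → (c : Edg G) → Joins G c b a → 1 ≤ length es → suc (length es) % 2 ≡ 0 →
             WalkComponent

  vertices : WalkComponent → List (Vtx G)
  vertices (pathᵂ  {vs = vs} _)         = vs
  vertices (cycleᵂ {vs = vs} _ _ _ _ _) = vs

  edges : WalkComponent → List (Edg G)
  edges (pathᵂ  {es = es} _)         = es
  edges (cycleᵂ {es = es} _ c _ _ _) = c ∷ es

  isPathᵂ : WalkComponent → Bool
  isPathᵂ (pathᵂ _)          = true
  isPathᵂ (cycleᵂ _ _ _ _ _) = false

  isEvenPathᵂ : WalkComponent → Bool
  isEvenPathᵂ (pathᵂ {es = es} _) = isEven (length es)
  isEvenPathᵂ (cycleᵂ _ _ _ _ _)  = false

  length-vertices≡edges+isPath : ∀ C → length (vertices C) ≡ length (edges C) + bit (isPathᵂ C)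
  length-vertices≡edges+isPath (pathᵂ {es = es} w) = trans (length-vertices w) (+-comm 1 (length es))
  length-vertices≡edges+isPath (cycleᵂ w _ _ _ _)   = trans (length-vertices w) (sym (+-identityʳ _))

  endpoint∈vertices : ∀ C {e w} → e ∈ edges C → Incident G w e → w ∈ vertices C
  endpoint∈vertices (pathᵂ w)          e∈ w∈e = endpoint∈ w e∈ w∈e
  endpoint∈vertices (cycleᵂ w c j _ _) (here refl) w∈c with Incident-Joins j w∈c
  ... | inj₁ refl = end∈ w
  ... | inj₂ refl = start∈ w
  endpoint∈vertices (cycleᵂ w _ _ _ _) (there e∈) w∈e = endpoint∈ w e∈ w∈e

  isEvenPath-path : ∀ P → isEvenPath G (path P) ≡ isEven (PathData.len P)
  isEvenPath-path P with PathData.len P % 2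
  ... | zero  = refl
  ... | suc _ = refl

  toComponent : (C : WalkComponent) → Unique (vertices C) → Unique (edges C) → Component G
  toComponent (pathᵂ w)          uv ue = path (toPathData w uv ue)
  toComponent (cycleᵂ {es = es} w c j l even) uv ue =
    evenCycle (toPathData w uv (U.tail ue)) c l even
      (λ i eq → Unique[x∷xs]⇒x∉xs ue (subst (_∈ es) eq (edgeAt∈ w i)))
      (subst₂ (Joins G c) (sym (vertexAt-last w)) (sym (vertexAt-zero w)) j)

  isPath-toComponent : ∀ C uv ue → isPath G (toComponent C uv ue) ≡ isPathᵂ C
  isPath-toComponent (pathᵂ _)          _ _ = refl
  isPath-toComponent (cycleᵂ _ _ _ _ _) _ _ = refl

  isEvenPath-toComponent : ∀ C uv ue → isEvenPath G (toComponent C uv ue) ≡ isEvenPathᵂ C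
  isEvenPath-toComponent (pathᵂ w) uv ue = isEvenPath-path (toPathData w uv ue)
  isEvenPath-toComponent (cycleᵂ _ _ _ _ _)  _ _ = refl

  ∈vertices⇒InComp : ∀ {v} C uv ue → v ∈ vertices C → InComp G v (toComponent C uv ue)
  ∈vertices⇒InComp (pathᵂ w)          _ _ v∈ = ∈⇒vertexAt w v∈
  ∈vertices⇒InComp (cycleᵂ w _ _ _ _) _ _ v∈ = ∈⇒vertexAt w v∈

  InComp⇒∈vertices : ∀ {v} C uv ue → InComp G v (toComponent C uv ue) → v ∈ vertices C
  InComp⇒∈vertices (pathᵂ w)          _ _ (i , refl) = vertexAt∈ w i
  InComp⇒∈vertices (cycleᵂ w _ _ _ _) _ _ (i , refl) = vertexAt∈ w i

  allVertices : List WalkComponent → List (Vtx G)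
  allVertices = concatMap vertices

  allEdges : List WalkComponent → List (Edg G)
  allEdges = concatMap edges

  record WalkDecomposition (Cs : List WalkComponent) : Set where
    field
      vertices-unique : Unique (allVertices Cs)
      edges-unique    : Unique (allEdges Cs)
      covers          : ∀ v → v ∈ allVertices Cs

  module _ {Cs : List WalkComponent} (D : WalkDecomposition Cs) where
    open WalkDecomposition D

    private
      componentAt : Fin (length Cs) → Component G
      componentAt i = toComponent (lookup Cs i)
        (unique-concatMap-∈ vertices vertices-unique (∈-lookup {xs = Cs} i))
        (unique-concatMap-∈ edges edges-unique (∈-lookup {xs = Cs} i))

    toPecDecomp : PecDecomp G
    toPecDecomp = record
      { c        = length Cs
      ; comp     = componentAt
      ; covers   = λ v → let v∈ = ∈-concatMap⁻ vertices {xs = Cs} (covers v) in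
                         Any.index v∈ , ∈vertices⇒InComp (lookup Cs (Any.index v∈)) _ _ (lookup-index v∈)
      ; disjoint = λ v i j v∈i v∈j → concatMap-unique-index vertices Cs vertices-unique i j
                     (InComp⇒∈vertices (lookup Cs i) _ _ v∈i) (InComp⇒∈vertices (lookup Cs j) _ _ v∈j)
      }

    pCount-toPecDecomp : pCount G toPecDecomp ≡ countᵇ isPathᵂ Cs
    pCount-toPecDecomp = trans (∣tabulate∣≡countᵇ (lookup Cs) _ isPathᵂ (λ i → isPath-toComponent (lookup Cs i) _ _))
                               (cong (countᵇ isPathᵂ) (tabulate-lookup Cs))

    eCount-toPecDecomp : eCount G toPecDecomp ≡ countᵇ isEvenPathᵂ Cs
    eCount-toPecDecomp = trans (∣tabulate∣≡countᵇ (lookup Cs) _ isEvenPathᵂ (λ i → isEvenPath-toComponent (lookup Cs i) _ _))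
                               (cong (countᵇ isEvenPathᵂ) (tabulate-lookup Cs))

    n≡length-allVertices : n G ≡ length (allVertices Cs)
    n≡length-allVertices = trans (sym (length-tabulate (λ v → v)))
      (length-unique-≡ (allFin⁺ _) vertices-unique (λ v _ → covers v) (λ v _ → ∈-allFin v))

  length-allVertices : ∀ Cs → length (allVertices Cs) ≡ length (allEdges Cs) + countᵇ isPathᵂ Cs
  length-allVertices []       = refl
  length-allVertices (C ∷ Cs) = begin
    length (vertices C ++ allVertices Cs)
      ≡⟨ length-++ (vertices C) ⟩
    length (vertices C) + length (allVertices Cs)
      ≡⟨ cong₂ _+_ (length-vertices≡edges+isPath C) (length-allVertices Cs) ⟩
    (length (edges C) + bit (isPathᵂ C)) + (length (allEdges Cs) + countᵇ isPathᵂ Cs)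
      ≡⟨ interchange (length (edges C)) _ _ _ ⟩
    (length (edges C) + length (allEdges Cs)) + (bit (isPathᵂ C) + countᵇ isPathᵂ Cs)
      ≡⟨ cong (_+ countᵇ isPathᵂ (C ∷ Cs)) (length-++ (edges C)) ⟨
    length (edges C ++ allEdges Cs) + countᵇ isPathᵂ (C ∷ Cs) ∎
    where open ≡-Reasoning

  fromComponent : Component G → WalkComponent
  fromComponent (path P) = pathᵂ (pathWalk P)
  fromComponent (evenCycle P c l even _ j) =
    cycleᵂ (pathWalk P) c j (subst (1 ≤_) (sym (length-tabulate (PathData.es P))) l)
           (subst (λ k → suc k % 2 ≡ 0) (sym (length-tabulate (PathData.es P))) even)

  InComp⇒∈vertices-fromComponent : ∀ {v} C → InComp G v C → v ∈ vertices (fromComponent C)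
  InComp⇒∈vertices-fromComponent (path P) (i , refl) = ∈-tabulate⁺ {f = PathData.vs P} i
  InComp⇒∈vertices-fromComponent (evenCycle P _ _ _ _ _) (i , refl) = ∈-tabulate⁺ {f = PathData.vs P} i

  ∈vertices-fromComponent⇒InComp : ∀ {v} C → v ∈ vertices (fromComponent C) → InComp G v C
  ∈vertices-fromComponent⇒InComp (path P) v∈ with ∈-tabulate⁻ {f = PathData.vs P} v∈
  ... | i , refl = i , refl
  ∈vertices-fromComponent⇒InComp (evenCycle P _ _ _ _ _) v∈ with ∈-tabulate⁻ {f = PathData.vs P} v∈
  ... | i , refl = i , refl

  unique-vertices-fromComponent : ∀ C → Unique (vertices (fromComponent C))
  unique-vertices-fromComponent (path P)                = tabulate⁺ (PathData.vs-inj P)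
  unique-vertices-fromComponent (evenCycle P _ _ _ _ _) = tabulate⁺ (PathData.vs-inj P)

  unique-edges-fromComponent : ∀ C → Unique (edges (fromComponent C))
  unique-edges-fromComponent (path P) = tabulate⁺ (PathData.es-inj P)
  unique-edges-fromComponent (evenCycle P c _ _ c∉ _) =
    unique-∷ (λ c∈ → let i , c≡ = ∈-tabulate⁻ {f = PathData.es P} c∈ in c∉ i (sym c≡)) (tabulate⁺ (PathData.es-inj P))

  module _ (D : PecDecomp G) where
    open PecDecomp D

    fromPecDecomp : List WalkComponent
    fromPecDecomp = L.tabulate (λ i → fromComponent (comp i))

    private
      vertices-disjoint : ∀ {i j v} → i ≢ j →
        v ∈ vertices (fromComponent (comp i)) → v ∈ vertices (fromComponent (comp j)) → ⊥
      vertices-disjoint {i} {j} i≢j v∈i v∈j =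
        i≢j (disjoint _ i j (∈vertices-fromComponent⇒InComp (comp i) v∈i) (∈vertices-fromComponent⇒InComp (comp j) v∈j))

    fromPecDecomp-decomposition : WalkDecomposition fromPecDecomp
    fromPecDecomp-decomposition = record
      { vertices-unique = unique-concatMap-tabulate vertices _ (λ i → unique-vertices-fromComponent (comp i)) vertices-disjoint
      ; edges-unique    = unique-concatMap-tabulate edges _ (λ i → unique-edges-fromComponent (comp i))
          (λ {i} {j} i≢j e∈i e∈j → vertices-disjoint i≢j (endpoint∈vertices (fromComponent (comp i)) e∈i (inj₁ refl))
                                                         (endpoint∈vertices (fromComponent (comp j)) e∈j (inj₁ refl)))
      ; covers          = λ v → let i , v∈i = PecDecomp.covers D v in
                                ∈-concatMap⁺ vertices (Any.tabulate⁺ i (InComp⇒∈vertices-fromComponent (comp i) v∈i))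
      }

    pCount≡countᵇ-fromPecDecomp : pCount G D ≡ countᵇ isPathᵂ fromPecDecomp
    pCount≡countᵇ-fromPecDecomp = ∣tabulate∣≡countᵇ _ _ isPathᵂ (λ i → isPath≡ (comp i))
      where
        isPath≡ : ∀ C → isPath G C ≡ isPathᵂ (fromComponent C)
        isPath≡ (path P)                = refl
        isPath≡ (evenCycle P _ _ _ _ _) = refl

    eCount≡countᵇ-fromPecDecomp : eCount G D ≡ countᵇ isEvenPathᵂ fromPecDecomp
    eCount≡countᵇ-fromPecDecomp = ∣tabulate∣≡countᵇ _ _ isEvenPathᵂ (λ i → isEvenPath≡ (comp i))
      where
        isEvenPath≡ : ∀ C → isEvenPath G C ≡ isEvenPathᵂ (fromComponent C)
        isEvenPath≡ (path P) = trans (isEvenPath-path P) (cong isEven (sym (length-tabulate (PathData.es P))))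
        isEvenPath≡ (evenCycle P _ _ _ _ _) = refl

  WalkDecomposition-↭ : ∀ {Cs Cs′} → Cs ↭ Cs′ → WalkDecomposition Cs → WalkDecomposition Cs′
  WalkDecomposition-↭ Cs↭ W = record
    { vertices-unique = Unique-resp-↭ (concatMap-↭ vertices Cs↭) vertices-unique
    ; edges-unique    = Unique-resp-↭ (concatMap-↭ edges Cs↭) edges-unique
    ; covers          = λ v → ∈-resp-↭ (concatMap-↭ vertices Cs↭) (covers v)
    }
    where open WalkDecomposition W

  component-containing : ∀ Cs {w} → w ∈ allVertices Cs →
    Σ WalkComponent λ C → Σ (List WalkComponent) λ R → Cs ↭ C ∷ R × w ∈ vertices C
  component-containing Cs w∈ with find (∈-concatMap⁻ vertices {xs = Cs} w∈)
  ... | C , C∈ , w∈C with ∈⇒↭∷ C∈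
  ...   | R , Cs↭ = C , R , Cs↭ , w∈C

module AlternatingMatchings (G : Graph) where

  open ListLemmas
  open Counting
  open Parity
  open Walks G
  open Decompositions G
  open import Data.Nat using (suc; _+_)
  open import Data.Nat.Properties using (+-comm; +-assoc; +-suc; +-identityʳ; +-commutativeSemigroup)
  open import Algebra.Properties.CommutativeSemigroup +-commutativeSemigroup using (interchange)
  open import Data.Bool using (true; false; not)
  open import Data.Empty using (⊥)
  open import Data.Product using (Σ; _×_; _,_; proj₁)
  open import Data.Fin.Subset using (∣_∣)
  open import Data.Sum using (inj₁; inj₂)
  open import Data.List using (List; []; _∷_; _++_; length; concatMap)
  open import Data.List.Properties using (length-++)
  open import Data.List.Membership.Propositional using (_∈_; find)
  open import Data.List.Membership.Propositional.Properties using (∈-concatMap⁻)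
  open import Data.List.Relation.Unary.Any using (here; there)
  open import Data.List.Relation.Unary.Unique.Propositional as U using (Unique)
  open import Data.List.Relation.Unary.Unique.Propositional.Properties using (Unique[x∷xs]⇒x∉xs)
  open import Relation.Nullary using (¬_)
  open import Relation.Binary.PropositionalEquality using (_≡_; _≢_; refl; trans; cong; cong₂; module ≡-Reasoning)

  private
    variable
      a b : Vtx G
      vs : List (Vtx G)
      es fs : List (Edg G)

  SharedVertex : Edg G → Edg G → Set
  SharedVertex e f = Σ (Vtx G) λ v → Incident G v e × Incident G v f

  MatchingList : List (Edg G) → Set
  MatchingList xs = ∀ e f → e ∈ xs → f ∈ xs → e ≢ f → ¬ SharedVertex e f

  matching-∷ : ∀ {e} → MatchingList fs → (∀ f → f ∈ fs → ¬ SharedVertex e f) → MatchingList (e ∷ fs)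
  matching-∷ match new _ _ (here refl) (here refl) e≢f _               = e≢f refl
  matching-∷ match new _ f (here refl) (there f∈)  _   shared          = new f f∈ shared
  matching-∷ match new e _ (there e∈)  (here refl) _   (v , v∈e , v∈f) = new e e∈ (v , v∈f , v∈e)
  matching-∷ match new e f (there e∈)  (there f∈)  e≢f shared          = match e f e∈ f∈ e≢f shared

  start≢end : Walk a b vs es → Unique vs → isEven (length es) ≡ false → a ≢ b
  start≢end (step _ _ w) uv _ refl = Unique[x∷xs]⇒x∉xs uv (end∈ w)

  -- The invariant that lets an alternating colouring of a walk be extended by one edge at its start.
  record AlternatingWalk (w : Walk a b vs es) : Set where
    field
      evens-matching : MatchingList (evens es)
      odds-matching  : MatchingList (odds es)
      start∉odds     : ∀ x → x ∈ odds es → ¬ Incident G a x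
      end∉odds       : isEven (length es) ≡ false → ∀ x → x ∈ odds es → ¬ Incident G b x
      end∉evens      : isEven (length es) ≡ true → ∀ x → x ∈ evens es → ¬ Incident G b x

  alternatingWalk : (w : Walk a b vs es) → Unique vs → AlternatingWalk w
  alternatingWalk (stop v) _ = record
    { evens-matching = λ _ _ ()
    ; odds-matching  = λ _ _ ()
    ; start∉odds     = λ _ ()
    ; end∉odds       = λ ()
    ; end∉evens      = λ _ _ ()
    }
  alternatingWalk {a = u} {b = b} (step {es = es} e j w) uv = record
    { evens-matching = matching-∷ odds-matching e∉odds
    ; odds-matching  = evens-matching
    ; start∉odds     = λ x x∈ u∈x → u∉rest (evens-⊆ es x∈) u∈x
    ; end∉odds       = λ odd x x∈ → end∉evens (isEven-pred (length es) odd) x x∈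
    ; end∉evens      = end∉e∷odds
    }
    where
      open AlternatingWalk (alternatingWalk w (U.tail uv))
      u∉rest : ∀ {x} → x ∈ es → ¬ Incident G u x
      u∉rest x∈ u∈x = Unique[x∷xs]⇒x∉xs uv (endpoint∈ w x∈ u∈x)
      e∉odds : ∀ x → x ∈ odds es → ¬ SharedVertex e x
      e∉odds x x∈ (y , y∈e , y∈x) with Incident-Joins j y∈e
      ... | inj₁ refl = u∉rest (odds-⊆ es x∈) y∈x
      ... | inj₂ refl = start∉odds x x∈ y∈x
      end∉e∷odds : isEven (suc (length es)) ≡ true → ∀ x → x ∈ e ∷ odds es → ¬ Incident G b x
      end∉e∷odds even x (there x∈) b∈x = end∉odds (isEven-pred (length es) even) x x∈ b∈x
      end∉e∷odds even x (here refl) b∈e with Incident-Joins j b∈e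
      ... | inj₁ refl = Unique[x∷xs]⇒x∉xs uv (end∈ w)
      ... | inj₂ refl = start≢end w (U.tail uv) (isEven-pred (length es) even) refl

  redEdges blueEdges : WalkComponent → List (Edg G)
  redEdges  (pathᵂ  {es = es} _)         = evens es
  redEdges  (cycleᵂ {es = es} _ _ _ _ _) = evens es
  blueEdges (pathᵂ  {es = es} _)         = odds es
  blueEdges (cycleᵂ {es = es} _ c _ _ _) = c ∷ odds es

  red⊆edges : ∀ C {e} → e ∈ redEdges C → e ∈ edges C
  red⊆edges (pathᵂ  {es = es} _)         e∈ = evens-⊆ es e∈
  red⊆edges (cycleᵂ {es = es} _ _ _ _ _) e∈ = there (evens-⊆ es e∈)

  blue⊆edges : ∀ C {e} → e ∈ blueEdges C → e ∈ edges C
  blue⊆edges (pathᵂ  {es = es} _)         e∈          = odds-⊆ es e∈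
  blue⊆edges (cycleᵂ {es = es} _ _ _ _ _) (here refl) = here refl
  blue⊆edges (cycleᵂ {es = es} _ _ _ _ _) (there e∈)  = there (odds-⊆ es e∈)

  unique-red : ∀ C → Unique (edges C) → Unique (redEdges C)
  unique-red (pathᵂ  {es = es} _)         ue = evens⁺ es ue
  unique-red (cycleᵂ {es = es} _ _ _ _ _) ue = evens⁺ es (U.tail ue)

  unique-blue : ∀ C → Unique (edges C) → Unique (blueEdges C)
  unique-blue (pathᵂ  {es = es} _)         ue = odds⁺ es ue
  unique-blue (cycleᵂ {es = es} _ _ _ _ _) ue =
    unique-∷ (λ c∈ → Unique[x∷xs]⇒x∉xs ue (odds-⊆ es c∈)) (odds⁺ es (U.tail ue))

  red-blue-disjoint : ∀ C → Unique (edges C) → ∀ {e} → e ∈ redEdges C → e ∈ blueEdges C → ⊥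
  red-blue-disjoint (pathᵂ  {es = es} _)         ue e∈r e∈b          = evens-odds-disjoint es ue e∈r e∈b
  red-blue-disjoint (cycleᵂ {es = es} _ _ _ _ _) ue e∈r (here refl) = Unique[x∷xs]⇒x∉xs ue (evens-⊆ es e∈r)
  red-blue-disjoint (cycleᵂ {es = es} _ _ _ _ _) ue e∈r (there e∈b) = evens-odds-disjoint es (U.tail ue) e∈r e∈b

  red-matching : ∀ C → Unique (vertices C) → MatchingList (redEdges C)
  red-matching (pathᵂ  w)          uv = AlternatingWalk.evens-matching (alternatingWalk w uv)
  red-matching (cycleᵂ w _ _ _ _)  uv = AlternatingWalk.evens-matching (alternatingWalk w uv)

  blue-matching : ∀ C → Unique (vertices C) → MatchingList (blueEdges C)
  blue-matching (pathᵂ w)                     uv = AlternatingWalk.odds-matching (alternatingWalk w uv)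
  blue-matching (cycleᵂ {es = es} w c j _ even) uv = matching-∷ odds-matching c∉odds
    where
      open AlternatingWalk (alternatingWalk w uv)
      c∉odds : ∀ x → x ∈ odds es → ¬ SharedVertex c x
      c∉odds x x∈ (v , v∈c , v∈x) with Incident-Joins j v∈c
      ... | inj₁ refl = end∉odds (suc%2≡0⇒odd (length es) even) x x∈ v∈x
      ... | inj₂ refl = start∉odds x x∈ v∈x

  length-red+blue : ∀ C → length (redEdges C) + length (blueEdges C) ≡ length (edges C)
  length-red+blue (pathᵂ  {es = es} _)         = length-evens+odds es
  length-red+blue (cycleᵂ {es = es} _ _ _ _ _) = trans (+-suc (length (evens es)) _) (cong suc (length-evens+odds es))

  red+isEven≡blue+isPath : ∀ C →
    length (redEdges C) + bit (isEvenPathᵂ C) ≡ length (blueEdges C) + bit (isPathᵂ C)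
  red+isEven≡blue+isPath (pathᵂ {es = es} _) = begin
    length (evens es) + bit (isEven (length es))
      ≡⟨ cong (_+ bit (isEven (length es))) (length-evens es) ⟩
    length (odds es) + oddBit (length es) + bit (isEven (length es))
      ≡⟨ +-assoc (length (odds es)) _ _ ⟩
    length (odds es) + (oddBit (length es) + bit (isEven (length es)))
      ≡⟨ cong (length (odds es) +_) (oddBit+evenBit≡1 (length es)) ⟩
    length (odds es) + 1 ∎
    where open ≡-Reasoning
  red+isEven≡blue+isPath (cycleᵂ {es = es} _ _ _ _ even) = begin
    length (evens es) + 0                             ≡⟨ +-identityʳ _ ⟩
    length (evens es)                                 ≡⟨ length-evens es ⟩
    length (odds es) + bit (not (isEven (length es))) ≡⟨ cong (λ b → length (odds es) + bit (not b)) odd ⟩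
    length (odds es) + 1                              ≡⟨ +-comm (length (odds es)) 1 ⟩
    suc (length (odds es))                            ≡⟨ +-identityʳ _ ⟨
    suc (length (odds es)) + 0                        ∎
    where
      open ≡-Reasoning
      odd : isEven (length es) ≡ false
      odd = suc%2≡0⇒odd (length es) even

  isMatching-toSubset : ∀ {es} → MatchingList es → IsMatching G (toSubset es)
  isMatching-toSubset match e f e∈ f∈ = match e f (∈-toSubset⁻ _ e∈) (∈-toSubset⁻ _ f∈)

  length-reds+blues : ∀ Cs → length (concatMap redEdges Cs) + length (concatMap blueEdges Cs) ≡ length (allEdges Cs)
  length-reds+blues []       = refl
  length-reds+blues (C ∷ Cs) = begin
    length (redEdges C ++ concatMap redEdges Cs) + length (blueEdges C ++ concatMap blueEdges Cs)
      ≡⟨ cong₂ _+_ (length-++ (redEdges C)) (length-++ (blueEdges C)) ⟩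
    (length (redEdges C) + length (concatMap redEdges Cs)) + (length (blueEdges C) + length (concatMap blueEdges Cs))
      ≡⟨ interchange (length (redEdges C)) _ _ _ ⟩
    (length (redEdges C) + length (blueEdges C)) + (length (concatMap redEdges Cs) + length (concatMap blueEdges Cs))
      ≡⟨ cong₂ _+_ (length-red+blue C) (length-reds+blues Cs) ⟩
    length (edges C) + length (allEdges Cs)
      ≡⟨ length-++ (edges C) ⟨
    length (edges C ++ allEdges Cs) ∎
    where open ≡-Reasoning

  reds+isEven≡blues+isPath : ∀ Cs → length (concatMap redEdges Cs) + countᵇ isEvenPathᵂ Cs
                                  ≡ length (concatMap blueEdges Cs) + countᵇ isPathᵂ Cs
  reds+isEven≡blues+isPath []       = refl
  reds+isEven≡blues+isPath (C ∷ Cs) = begin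
    length (redEdges C ++ concatMap redEdges Cs) + (bit (isEvenPathᵂ C) + countᵇ isEvenPathᵂ Cs)
      ≡⟨ cong (_+ (bit (isEvenPathᵂ C) + countᵇ isEvenPathᵂ Cs)) (length-++ (redEdges C)) ⟩
    (length (redEdges C) + length (concatMap redEdges Cs)) + (bit (isEvenPathᵂ C) + countᵇ isEvenPathᵂ Cs)
      ≡⟨ interchange (length (redEdges C)) _ _ _ ⟩
    (length (redEdges C) + bit (isEvenPathᵂ C)) + (length (concatMap redEdges Cs) + countᵇ isEvenPathᵂ Cs)
      ≡⟨ cong₂ _+_ (red+isEven≡blue+isPath C) (reds+isEven≡blues+isPath Cs) ⟩
    (length (blueEdges C) + bit (isPathᵂ C)) + (length (concatMap blueEdges Cs) + countᵇ isPathᵂ Cs)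
      ≡⟨ interchange (length (blueEdges C)) _ _ _ ⟩
    (length (blueEdges C) + length (concatMap blueEdges Cs)) + (bit (isPathᵂ C) + countᵇ isPathᵂ Cs)
      ≡⟨ cong (_+ (bit (isPathᵂ C) + countᵇ isPathᵂ Cs)) (length-++ (blueEdges C)) ⟨
    length (blueEdges C ++ concatMap blueEdges Cs) + (bit (isPathᵂ C) + countᵇ isPathᵂ Cs) ∎
    where open ≡-Reasoning

  module _ {Cs : List WalkComponent} (W : WalkDecomposition Cs) where
    open WalkDecomposition W

    private
      same-component : ∀ {C C′ v} → C ∈ Cs → C′ ∈ Cs → v ∈ vertices C → v ∈ vertices C′ → C ≡ C′
      same-component = concatMap-unique-∈ {xs = Cs} vertices vertices-unique

      unique-vertices : ∀ {C} → C ∈ Cs → Unique (vertices C)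
      unique-vertices = unique-concatMap-∈ {xs = Cs} vertices vertices-unique

      unique-edges : ∀ {C} → C ∈ Cs → Unique (edges C)
      unique-edges = unique-concatMap-∈ {xs = Cs} edges edges-unique

      sharing-component : ∀ (s s′ : WalkComponent → List (Edg G)) →
        (∀ C {e} → e ∈ s C → e ∈ edges C) → (∀ C {e} → e ∈ s′ C → e ∈ edges C) →
        ∀ {e f v} → e ∈ concatMap s Cs → f ∈ concatMap s′ Cs → Incident G v e → Incident G v f →
        Σ WalkComponent λ C → C ∈ Cs × e ∈ s C × f ∈ s′ C
      sharing-component s s′ s⊆ s′⊆ e∈ f∈ v∈e v∈f
        with find (∈-concatMap⁻ s {xs = Cs} e∈) | find (∈-concatMap⁻ s′ {xs = Cs} f∈)
      ... | C , C∈ , e∈C | C′ , C′∈ , f∈C′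
        with same-component C∈ C′∈ (endpoint∈vertices C (s⊆ C e∈C) v∈e) (endpoint∈vertices C′ (s′⊆ C′ f∈C′) v∈f)
      ... | refl = C , C∈ , e∈C , f∈C′

      matching-concatMap : ∀ (s : WalkComponent → List (Edg G)) → (∀ C {e} → e ∈ s C → e ∈ edges C) →
        (∀ C → Unique (vertices C) → MatchingList (s C)) → MatchingList (concatMap s Cs)
      matching-concatMap s s⊆ match e f e∈ f∈ e≢f (v , v∈e , v∈f)
        with sharing-component s s s⊆ s⊆ e∈ f∈ v∈e v∈f
      ... | C , C∈ , e∈C , f∈C = match C (unique-vertices C∈) e f e∈C f∈C e≢f (v , v∈e , v∈f)

      unique-colour : ∀ (s : WalkComponent → List (Edg G)) → (∀ C {e} → e ∈ s C → e ∈ edges C) →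
        (∀ C → Unique (edges C) → Unique (s C)) → Unique (concatMap s Cs)
      unique-colour s s⊆ us = unique-concatMap-anchored {xs = Cs} vertices s (λ e → proj₁ (ends G e)) vertices-unique
        (λ C C∈ → us C (unique-edges C∈)) (λ C e∈ → endpoint∈vertices C (s⊆ C e∈) (inj₁ refl))

    colouring-disjoint : DisjointSets G (toSubset (concatMap redEdges Cs)) (toSubset (concatMap blueEdges Cs))
    colouring-disjoint e e∈r e∈b
      with sharing-component redEdges blueEdges red⊆edges blue⊆edges
             (∈-toSubset⁻ _ e∈r) (∈-toSubset⁻ _ e∈b) (inj₁ refl) (inj₁ refl)
    ... | C , C∈ , e∈rC , e∈bC = red-blue-disjoint C (unique-edges C∈) e∈rC e∈bC

    colouring-matchings : DisjMatchings G (toSubset (concatMap redEdges Cs)) (toSubset (concatMap blueEdges Cs))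
    colouring-matchings = isMatching-toSubset (matching-concatMap redEdges red⊆edges red-matching)
                        , isMatching-toSubset (matching-concatMap blueEdges blue⊆edges blue-matching)
                        , colouring-disjoint

    ∣reds∣ : ∣ toSubset (concatMap redEdges Cs) ∣ ≡ length (concatMap redEdges Cs)
    ∣reds∣ = ∣toSubset∣ (unique-colour redEdges red⊆edges unique-red)

    ∣blues∣ : ∣ toSubset (concatMap blueEdges Cs) ∣ ≡ length (concatMap blueEdges Cs)
    ∣blues∣ = ∣toSubset∣ (unique-colour blueEdges blue⊆edges unique-blue)

  decomposition⇒matchings : (D : PecDecomp G) → Σ (Subset (m G)) λ H → Σ (Subset (m G)) λ H′ →
    DisjMatchings G H H′ × ∣ H ∣ + ∣ H′ ∣ + pCount G D ≡ n G × ∣ H ∣ + eCount G D ≡ ∣ H′ ∣ + pCount G D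
  decomposition⇒matchings D = toSubset reds , toSubset blues , colouring-matchings W , size , balance
    where
      Cs : List WalkComponent
      Cs = fromPecDecomp D
      W : WalkDecomposition Cs
      W = fromPecDecomp-decomposition D
      reds blues : List (Edg G)
      reds  = concatMap redEdges Cs
      blues = concatMap blueEdges Cs
      open ≡-Reasoning
      size : ∣ toSubset reds ∣ + ∣ toSubset blues ∣ + pCount G D ≡ n G
      size = begin
        ∣ toSubset reds ∣ + ∣ toSubset blues ∣ + pCount G D
          ≡⟨ cong₂ _+_ (cong₂ _+_ (∣reds∣ W) (∣blues∣ W)) (pCount≡countᵇ-fromPecDecomp D) ⟩
        length reds + length blues + countᵇ isPathᵂ Cs  ≡⟨ cong (_+ countᵇ isPathᵂ Cs) (length-reds+blues Cs) ⟩
        length (allEdges Cs) + countᵇ isPathᵂ Cs        ≡⟨ length-allVertices Cs ⟨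
        length (allVertices Cs)                         ≡⟨ n≡length-allVertices W ⟨
        n G                                             ∎
      balance : ∣ toSubset reds ∣ + eCount G D ≡ ∣ toSubset blues ∣ + pCount G D
      balance = begin
        ∣ toSubset reds ∣ + eCount G D    ≡⟨ cong₂ _+_ (∣reds∣ W) (eCount≡countᵇ-fromPecDecomp D) ⟩
        length reds + countᵇ isEvenPathᵂ Cs ≡⟨ reds+isEven≡blues+isPath Cs ⟩
        length blues + countᵇ isPathᵂ Cs    ≡⟨ cong₂ _+_ (∣blues∣ W) (pCount≡countᵇ-fromPecDecomp D) ⟨
        ∣ toSubset blues ∣ + pCount G D   ∎

module MatchingUnion (G : Graph) {H H′ : Subset (m G)} (dm : DisjMatchings G H H′) where

  open ListLemmas
  open Counting
  open Parity
  open Walks G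
  open Decompositions G
  open import Data.Nat using (ℕ; _+_; _≤_; z≤n; s≤s)
  open import Data.Nat.Properties using (+-comm; +-assoc; +-identityʳ; ≤-refl; ≤-reflexive; +-mono-≤; +-monoʳ-≤; +-monoˡ-≤; m≤m+n; +-commutativeSemigroup; module ≤-Reasoning)
  open import Algebra.Properties.CommutativeSemigroup +-commutativeSemigroup using (interchange)
  open import Data.Bool using (Bool; true; false; not; if_then_else_)
  open import Data.Bool.Properties using (not-involutive; not-¬)
  open import Data.Unit using (⊤; tt)
  open import Data.Empty using (⊥; ⊥-elim)
  open import Data.Fin.Subset using (∣_∣) renaming (_∈_ to _∈ₛ_)
  open import Data.Fin.Subset.Properties using () renaming (_∈?_ to _∈ₛ?_)
  import Data.Vec as V
  open import Data.Vec.Properties using ([]=⇒lookup; lookup⇒[]=)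
  open import Data.Product using (Σ; _×_; _,_; proj₁; proj₂)
  open import Data.Sum using (_⊎_; inj₁; inj₂)
  open import Function using (_∘_)
  open import Data.List using (List; []; _∷_; _++_; length)
  import Data.List as L
  open import Data.List.Membership.Propositional using (_∈_; _∉_)
  open import Data.List.Membership.Propositional.Properties using (∈-++⁺ˡ; ∈-++⁺ʳ; ∈-++⁻; ∈-allFin; ∈-filter⁺; ∈-filter⁻)
  open import Data.List.Relation.Unary.Any using (here; there)
  open import Data.List.Relation.Unary.Unique.Propositional as U using (Unique; [])
  open import Data.List.Relation.Unary.Unique.Propositional.Properties using (Unique[x∷xs]⇒x∉xs; allFin⁺; filter⁺)
  open import Data.List.Relation.Binary.Permutation.Propositional using (_↭_; ↭-refl; ↭-sym; ↭-trans; ↭-prep; ↭-reflexive)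
  open import Data.List.Relation.Binary.Permutation.Propositional.Properties using (∈-resp-↭; ↭-reverse; ++⁺; ++⁺ʳ; ++-assoc; shift)
  open import Relation.Nullary using (¬_; Dec; _⊎-dec_)
  open import Relation.Binary.PropositionalEquality using (_≡_; _≢_; refl; sym; trans; cong; cong₂; subst; subst₂; module ≡-Reasoning)

  private
    variable
      a b : Vtx G
      vs : List (Vtx G)
      es : List (Edg G)

  InUnion : Edg G → Set
  InUnion e = e ∈ₛ H ⊎ e ∈ₛ H′

  inH : Edg G → Bool
  inH e = V.lookup H e

  inH′-colour : ∀ {e} → e ∈ₛ H′ → inH e ≡ false
  inH′-colour {e} e∈H′ with inH e in eq
  ... | true  = ⊥-elim (proj₂ (proj₂ dm) e (lookup⇒[]= e H eq) e∈H′)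
  ... | false = refl

  lookup-H′ : ∀ {e} → InUnion e → V.lookup H′ e ≡ not (inH e)
  lookup-H′ {e} (inj₁ e∈H) rewrite []=⇒lookup e∈H with V.lookup H′ e in eq
  ... | true  = ⊥-elim (proj₂ (proj₂ dm) e e∈H (lookup⇒[]= e H′ eq))
  ... | false = refl
  lookup-H′ (inj₂ e∈H′) rewrite inH′-colour e∈H′ = []=⇒lookup e∈H′

  adjacent-opposite : ∀ {e f v} → InUnion e → InUnion f → e ≢ f → Incident G v e → Incident G v f → inH f ≡ not (inH e)
  adjacent-opposite {e} {f} {v} e∈ f∈ e≢f v∈e v∈f with inH e in eq₁ | inH f in eq₂
  ... | true  | true  = ⊥-elim (proj₁ dm e f (lookup⇒[]= e H eq₁) (lookup⇒[]= f H eq₂) e≢f (v , v∈e , v∈f))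
  ... | true  | false = refl
  ... | false | true  = refl
  ... | false | false = ⊥-elim (proj₁ (proj₂ dm) e f (in-H′ e∈ eq₁) (in-H′ f∈ eq₂) e≢f (v , v∈e , v∈f))
    where
      in-H′ : ∀ {x} → InUnion x → inH x ≡ false → x ∈ₛ H′
      in-H′ (inj₁ x∈H) eq with trans (sym ([]=⇒lookup x∈H)) eq
      ... | ()
      in-H′ (inj₂ x∈H′) _ = x∈H′

  no-three-at-vertex : ∀ {e₁ e₂ e₃ v} → InUnion e₁ → InUnion e₂ → InUnion e₃ → e₁ ≢ e₂ → e₁ ≢ e₃ → e₂ ≢ e₃ →
    Incident G v e₁ → Incident G v e₂ → Incident G v e₃ → ⊥
  no-three-at-vertex {e₁} i₁ i₂ i₃ e₁≢e₂ e₁≢e₃ e₂≢e₃ v₁ v₂ v₃ =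
    not-¬ refl (trans (sym (adjacent-opposite i₁ i₃ e₁≢e₃ v₁ v₃))
               (trans (adjacent-opposite i₂ i₃ e₂≢e₃ v₂ v₃) (cong not (adjacent-opposite i₁ i₂ e₁≢e₂ v₁ v₂))))

  Alternating : Bool → List (Edg G) → Set
  Alternating s []       = ⊤
  Alternating s (e ∷ es) = inH e ≡ s × Alternating (not s) es

  alternating-cons : ∀ {e e′ es v} → InUnion e → InUnion e′ → e ≢ e′ → Incident G v e → Incident G v e′ →
    Alternating (inH e′) (e′ ∷ es) → Alternating (inH e) (e ∷ e′ ∷ es)
  alternating-cons {e′ = e′} {es} e∈ e′∈ e≢e′ v∈e v∈e′ alt =
    refl , subst (λ s → Alternating s (e′ ∷ es)) (adjacent-opposite e∈ e′∈ e≢e′ v∈e v∈e′) alt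

  walk-alternating : ∀ {e} → Walk a b vs (e ∷ es) → Unique (e ∷ es) → (∀ x → x ∈ e ∷ es → InUnion x) →
    Alternating (inH e) (e ∷ es)
  walk-alternating (step e j (stop _))         _  _     = refl , tt
  walk-alternating (step e j (step e′ j′ w)) ue union =
    alternating-cons (union e (here refl)) (union e′ (there (here refl))) (λ e≡e′ → Unique[x∷xs]⇒x∉xs ue (here e≡e′))
      (Joins⇒Incidentʳ j) (Joins⇒Incidentˡ j′)
      (walk-alternating (step e′ j′ w) (U.tail ue) (λ x x∈ → union x (there x∈)))

  alternating-last : ∀ s e es → Alternating s (e ∷ es) → inH (last⁺ e es) ≡ (if isEven (length es) then s else not s)
  alternating-last s e []       (eq , _)  = eq
  alternating-last s e (f ∷ fs) (_ , alt) rewrite isEven-suc (length fs) =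
    trans (alternating-last (not s) f fs alt) (flip-if (isEven (length fs)))
    where
      flip-if : ∀ b → (if b then not s else not (not s)) ≡ (if not b then s else not s)
      flip-if true  = refl
      flip-if false = not-involutive s

  same-colour-ends⇒even : ∀ s e es → Alternating s (e ∷ es) → inH (last⁺ e es) ≡ s → isEven (length es) ≡ true
  same-colour-ends⇒even s e es alt eq with isEven (length es) | alternating-last s e es alt
  ... | true  | _    = refl
  ... | false | eq′ = ⊥-elim (not-¬ refl (sym (trans (sym eq′) eq)))

  #H #H′ : List (Edg G) → ℕ
  #H  = countᵇ inH
  #H′ = countᵇ (λ e → not (inH e))

  alternating-#H  : ∀ es → Alternating true es  → #H es  ≡ #H′ es + oddBit (length es)
  alternating-#H′ : ∀ es → Alternating false es → #H′ es ≡ #H es  + oddBit (length es)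
  alternating-#H  []       _          = refl
  alternating-#H  (e ∷ es) (eq , alt) rewrite eq | alternating-#H′ es alt = suc≡+oddBit+oddBit (#H es) (length es)
  alternating-#H′ []       _          = refl
  alternating-#H′ (e ∷ es) (eq , alt) rewrite eq | alternating-#H es alt = suc≡+oddBit+oddBit (#H′ es) (length es)

  alternating-path-balance : ∀ s es → Alternating s es → #H es + bit (isEven (length es)) ≤ #H′ es + 1
  alternating-path-balance true es alt = ≤-reflexive (begin
    #H es + bit (isEven (length es))                      ≡⟨ cong (_+ bit (isEven (length es))) (alternating-#H es alt) ⟩
    #H′ es + oddBit (length es) + bit (isEven (length es)) ≡⟨ +-assoc (#H′ es) _ _ ⟩
    #H′ es + (oddBit (length es) + bit (isEven (length es))) ≡⟨ cong (#H′ es +_) (oddBit+evenBit≡1 (length es)) ⟩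
    #H′ es + 1                                             ∎)
    where open ≡-Reasoning
  alternating-path-balance false es alt = begin
    #H es + bit (isEven (length es))  ≤⟨ +-monoʳ-≤ (#H es) (bit≤1 (isEven (length es))) ⟩
    #H es + 1                         ≤⟨ +-monoˡ-≤ 1 (m≤m+n (#H es) (oddBit (length es))) ⟩
    #H es + oddBit (length es) + 1    ≡⟨ cong (_+ 1) (alternating-#H′ es alt) ⟨
    #H′ es + 1                        ∎
    where
      open ≤-Reasoning
      bit≤1 : ∀ b → bit b ≤ 1
      bit≤1 true  = ≤-refl
      bit≤1 false = z≤n

  alternating-cycle-balance : ∀ s es → Alternating s es → isEven (length es) ≡ true → #H es ≡ #H′ es
  alternating-cycle-balance true es alt even = begin
    #H es                               ≡⟨ alternating-#H es alt ⟩
    #H′ es + bit (not (isEven (length es))) ≡⟨ cong (λ b → #H′ es + bit (not b)) even ⟩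
    #H′ es + 0                          ≡⟨ +-identityʳ _ ⟩
    #H′ es                              ∎
    where open ≡-Reasoning
  alternating-cycle-balance false es alt even = sym (begin
    #H′ es                              ≡⟨ alternating-#H′ es alt ⟩
    #H es + bit (not (isEven (length es))) ≡⟨ cong (λ b → #H es + bit (not b)) even ⟩
    #H es + 0                           ≡⟨ +-identityʳ _ ⟩
    #H es                               ∎)
    where open ≡-Reasoning

  component-balance : ∀ C → Unique (edges C) → (∀ e → e ∈ edges C → InUnion e) →
    #H (edges C) + bit (isEvenPathᵂ C) ≤ #H′ (edges C) + bit (isPathᵂ C)
  component-balance (pathᵂ (stop _)) _ _ = alternating-path-balance true [] tt
  component-balance (pathᵂ {es = e ∷ es} w) ue union =
    alternating-path-balance (inH e) (e ∷ es) (walk-alternating w ue union)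
  component-balance (cycleᵂ {es = e ∷ es} w@(step _ j′ _) c j _ even) ue union =
    ≤-reflexive (cong (_+ 0) (alternating-cycle-balance (inH c) (c ∷ e ∷ es) alt (%2≡0⇒isEven (length (c ∷ e ∷ es)) even)))
    where
      alt : Alternating (inH c) (c ∷ e ∷ es)
      alt = alternating-cons (union c (here refl)) (union e (there (here refl))) (λ c≡e → Unique[x∷xs]⇒x∉xs ue (here c≡e))
              (Joins⇒Incidentʳ j) (Joins⇒Incidentˡ j′) (walk-alternating w (U.tail ue) (λ x x∈ → union x (there x∈)))

  decomposition-balance : ∀ Cs → Unique (allEdges Cs) → (∀ e → e ∈ allEdges Cs → InUnion e) →
    #H (allEdges Cs) + countᵇ isEvenPathᵂ Cs ≤ #H′ (allEdges Cs) + countᵇ isPathᵂ Cs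
  decomposition-balance []       _  _     = ≤-refl
  decomposition-balance (C ∷ Cs) ue union = begin
    #H (edges C ++ allEdges Cs) + (bit (isEvenPathᵂ C) + countᵇ isEvenPathᵂ Cs)
      ≡⟨ cong (_+ (bit (isEvenPathᵂ C) + countᵇ isEvenPathᵂ Cs)) (countᵇ-++ inH (edges C) _) ⟩
    (#H (edges C) + #H (allEdges Cs)) + (bit (isEvenPathᵂ C) + countᵇ isEvenPathᵂ Cs)
      ≡⟨ interchange (#H (edges C)) _ _ _ ⟩
    (#H (edges C) + bit (isEvenPathᵂ C)) + (#H (allEdges Cs) + countᵇ isEvenPathᵂ Cs)
      ≤⟨ +-mono-≤ (component-balance C (unique-++ˡ (edges C) ue) (λ e e∈ → union e (∈-++⁺ˡ e∈)))
                  (decomposition-balance Cs (unique-++ʳ (edges C) ue) (λ e e∈ → union e (∈-++⁺ʳ (edges C) e∈))) ⟩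
    (#H′ (edges C) + bit (isPathᵂ C)) + (#H′ (allEdges Cs) + countᵇ isPathᵂ Cs)
      ≡⟨ interchange (#H′ (edges C)) _ _ _ ⟩
    (#H′ (edges C) + #H′ (allEdges Cs)) + (bit (isPathᵂ C) + countᵇ isPathᵂ Cs)
      ≡⟨ cong (_+ (bit (isPathᵂ C) + countᵇ isPathᵂ Cs)) (countᵇ-++ (λ e → not (inH e)) (edges C) _) ⟨
    #H′ (edges C ++ allEdges Cs) + (bit (isPathᵂ C) + countᵇ isPathᵂ Cs) ∎
    where open ≤-Reasoning

  -- A new edge f of H ∪ H′ can only meet ends of paths, since a third edge at a vertex would repeat a
  -- colour; so inserting it either joins two paths or closes one into a cycle.
  module Insertion (f : Edg G) (f∈ : InUnion f) where

    u v : Vtx G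
    u = proj₁ (ends G f)
    v = proj₂ (ends G f)

    record Fresh (es : List (Edg G)) : Set where
      field
        unique  : Unique es
        inUnion : ∀ e → e ∈ es → InUnion e
        f∉      : f ∉ es

      ≢f : ∀ {e} → e ∈ es → e ≢ f
      ≢f e∈ refl = f∉ e∈

    fresh-++ˡ : ∀ xs {ys} → Fresh (xs ++ ys) → Fresh xs
    fresh-++ˡ xs fr = record
      { unique = unique-++ˡ xs unique ; inUnion = λ e e∈ → inUnion e (∈-++⁺ˡ e∈) ; f∉ = λ f∈xs → f∉ (∈-++⁺ˡ f∈xs) }
      where open Fresh fr

    fresh-++ʳ : ∀ xs {ys} → Fresh (xs ++ ys) → Fresh ys
    fresh-++ʳ xs fr = record
      { unique = unique-++ʳ xs unique ; inUnion = λ e e∈ → inUnion e (∈-++⁺ʳ xs e∈) ; f∉ = λ f∈ys → f∉ (∈-++⁺ʳ xs f∈ys) }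
      where open Fresh fr

    fresh-↭ : ∀ {xs ys} → xs ↭ ys → Fresh xs → Fresh ys
    fresh-↭ xs↭ys fr = record
      { unique  = Unique-resp-↭ xs↭ys unique
      ; inUnion = λ e e∈ → inUnion e (∈-resp-↭ (↭-sym xs↭ys) e∈)
      ; f∉      = λ f∈ys → f∉ (∈-resp-↭ (↭-sym xs↭ys) f∈ys)
      }
      where open Fresh fr

    saturated : ∀ {es x y w} → Fresh es → x ∈ es → y ∈ es → x ≢ y → Incident G w x → Incident G w y → ¬ Incident G w f
    saturated fr x∈ y∈ x≢y w∈x w∈y w∈f =
      no-three-at-vertex (inUnion _ x∈) (inUnion _ y∈) f∈ x≢y (≢f x∈) (≢f y∈) w∈x w∈y w∈f
      where open Fresh fr

    end-of-walk : Walk a b vs es → Fresh es → ∀ {w} → w ∈ vs → Incident G w f → w ≡ a ⊎ w ≡ b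
    end-of-walk p fr w∈ w∈f with ∈-walk⇒end⊎inner p (Fresh.unique fr) w∈
    ... | inj₁ w≡a         = inj₁ w≡a
    ... | inj₂ (inj₁ w≡b)  = inj₂ w≡b
    ... | inj₂ (inj₂ (_ , _ , e₁∈ , e₂∈ , e₁≢e₂ , w∈e₁ , w∈e₂)) = ⊥-elim (saturated fr e₁∈ e₂∈ e₁≢e₂ w∈e₁ w∈e₂ w∈f)

    cycle-saturated : ∀ {c w} → Walk a b vs es → Joins G c b a → 1 ≤ length es → Fresh (c ∷ es) →
                      w ∈ vs → ¬ Incident G w f
    cycle-saturated {es = e ∷ es} {c = c} p j _ fr w∈ with ∈-walk⇒end⊎inner p (U.tail (Fresh.unique fr)) w∈
    ... | inj₁ refl =
      saturated fr (here refl) (there (here refl)) (λ c≡e → c∉ (here c≡e)) (Joins⇒Incidentʳ j) (start-incident p)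
      where c∉ = Unique[x∷xs]⇒x∉xs (Fresh.unique fr)
    ... | inj₂ (inj₁ refl) =
      saturated fr (here refl) (there (last⁺∈ e es)) (λ c≡ → c∉ (subst (_∈ e ∷ es) (sym c≡) (last⁺∈ e es)))
        (Joins⇒Incidentˡ j) (end-incident p)
      where c∉ = Unique[x∷xs]⇒x∉xs (Fresh.unique fr)
    ... | inj₂ (inj₂ (_ , _ , e₁∈ , e₂∈ , e₁≢e₂ , w∈e₁ , w∈e₂)) = saturated fr (there e₁∈) (there e₂∈) e₁≢e₂ w∈e₁ w∈e₂

    data PathEnd (w : Vtx G) : WalkComponent → Set where
      path-end : ∀ {a b vs es} (p : Walk a b vs es) → w ≡ a ⊎ w ≡ b → PathEnd w (pathᵂ p)

    touched-component : ∀ C {w} → Fresh (edges C) → w ∈ vertices C → Incident G w f → PathEnd w C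
    touched-component (pathᵂ p)          fr w∈ w∈f = path-end p (end-of-walk p fr w∈ w∈f)
    touched-component (cycleᵂ p _ j l _) fr w∈ w∈f = ⊥-elim (cycle-saturated p j l fr w∈ w∈f)

    WalkOn : List (Vtx G) → List (Edg G) → Vtx G → Vtx G → Set
    WalkOn vs es x y = Σ (List (Vtx G)) λ vs′ → Σ (List (Edg G)) λ es′ → Walk x y vs′ es′ × vs′ ↭ vs × es′ ↭ es

    ending-at : ∀ {w} → Walk a b vs es → w ≡ a ⊎ w ≡ b → Σ (Vtx G) λ x → WalkOn vs es x w
    ending-at p (inj₁ refl) = _ , _ , _ , reverse-walk p , ↭-reverse _ , ↭-reverse _
    ending-at p (inj₂ refl) = _ , _ , _ , p , ↭-refl , ↭-refl

    starting-at : ∀ {w} → Walk a b vs es → w ≡ a ⊎ w ≡ b → Σ (Vtx G) λ y → WalkOn vs es w y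
    starting-at p (inj₁ refl) = _ , _ , _ , p , ↭-refl , ↭-refl
    starting-at p (inj₂ refl) = _ , _ , _ , reverse-walk p , ↭-reverse _ , ↭-reverse _

    -- f closes a walk from v to u into a cycle, which is even because f, the first and the last edge alternate.
    close-cycle : Walk a b vs es → Fresh es → v ≡ a → u ≡ b → Σ WalkComponent λ C → vertices C ≡ vs × edges C ≡ f ∷ es
    close-cycle (stop _) _ v≡a u≡b = ⊥-elim (loopless G f (trans u≡b (sym v≡a)))
    close-cycle {es = e ∷ es} p@(step _ _ _) fr refl refl =
      cycleᵂ p f (inj₁ refl) (s≤s z≤n) (isEven⇒%2≡0 (length es) (same-colour-ends⇒even (inH e) e es alt same-colour)) ,
      refl , refl
      where
        open Fresh fr
        alt : Alternating (inH e) (e ∷ es)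
        alt = walk-alternating p unique inUnion
        same-colour : inH (last⁺ e es) ≡ inH e
        same-colour = trans (adjacent-opposite f∈ (inUnion _ last∈) (≢f last∈ ∘ sym) (inj₁ refl) (end-incident p))
                            (sym (adjacent-opposite f∈ (inUnion e first∈) (≢f first∈ ∘ sym) (inj₂ refl) (start-incident p)))
          where
            first∈ : e ∈ e ∷ es
            first∈ = here refl
            last∈ : last⁺ e es ∈ e ∷ es
            last∈ = last⁺∈ e es

    Inserted : List WalkComponent → Set
    Inserted Cs = Σ (List WalkComponent) λ Cs′ → allVertices Cs′ ↭ allVertices Cs × allEdges Cs′ ↭ f ∷ allEdges Cs

    Inserted-↭ : ∀ {Cs Cs′} → Cs ↭ Cs′ → Inserted Cs′ → Inserted Cs
    Inserted-↭ Cs↭ (Cs″ , V↭ , E↭) =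
      Cs″ , ↭-trans V↭ (concatMap-↭ vertices (↭-sym Cs↭)) , ↭-trans E↭ (↭-prep f (concatMap-↭ edges (↭-sym Cs↭)))

    close-path : (p : Walk a b vs es) → ∀ R → u ≡ a ⊎ u ≡ b → Fresh es → v ∈ vs → Inserted (pathᵂ p ∷ R)
    close-path p R u-end fr v∈ with ending-at p u-end
    ... | x , vs′ , es′ , p′ , vs↭ , es↭ with end-of-walk p′ (fresh-↭ (↭-sym es↭) fr) (∈-resp-↭ (↭-sym vs↭) v∈) (inj₂ refl)
    ...   | inj₂ v≡u = ⊥-elim (loopless G f (sym v≡u))
    ...   | inj₁ v≡x with close-cycle p′ (fresh-↭ (↭-sym es↭) fr) v≡x refl
    ...     | C , V≡ , E≡ = C ∷ R , ++⁺ʳ _ (↭-trans (↭-reflexive V≡) vs↭)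
                                  , ↭-trans (++⁺ʳ _ (↭-reflexive E≡)) (↭-prep f (++⁺ʳ _ es↭))

    join-paths : ∀ {c d ws fs x y} (p : Walk a b vs es) (q : Walk c d ws fs) R → WalkOn vs es x u → WalkOn ws fs v y →
                 Inserted (pathᵂ p ∷ pathᵂ q ∷ R)
    join-paths p q R (vs′ , es′ , p′ , vs↭ , es↭) (ws′ , fs′ , q′ , ws↭ , fs↭) =
      pathᵂ (connect f p′ (inj₁ refl) q′) ∷ R ,
      ↭-trans (++-assoc vs′ ws′ _) (++⁺ vs↭ (++⁺ʳ _ ws↭)) ,
      ↭-trans (++-assoc es′ (f ∷ fs′) _) (↭-trans (shift f es′ (fs′ ++ _)) (↭-prep f (++⁺ es↭ (++⁺ʳ _ fs↭))))

    join-into : (p : Walk a b vs es) → u ≡ a ⊎ u ≡ b → ∀ Cv R → Fresh (allEdges (Cv ∷ R)) → v ∈ vertices Cv →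
                Inserted (pathᵂ p ∷ Cv ∷ R)
    join-into p u-end Cv R fr v∈Cv with touched-component Cv (fresh-++ˡ (edges Cv) fr) v∈Cv (inj₂ refl)
    ... | path-end q v-end = join-paths p q R (proj₂ (ending-at p u-end)) (proj₂ (starting-at q v-end))

    join-components : (p : Walk a b vs es) → ∀ R → u ≡ a ⊎ u ≡ b → Fresh (allEdges R) → v ∈ allVertices R →
                      Inserted (pathᵂ p ∷ R)
    join-components p R u-end fr v∈R =
      let Cv , R′ , R↭ , v∈Cv = component-containing R v∈R in
      Inserted-↭ (↭-prep (pathᵂ p) R↭) (join-into p u-end Cv R′ (fresh-↭ (concatMap-↭ edges R↭) fr) v∈Cv)

    insert-into : ∀ Cu R → WalkDecomposition (Cu ∷ R) → Fresh (allEdges (Cu ∷ R)) → u ∈ vertices Cu → Inserted (Cu ∷ R)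
    insert-into Cu R W fr u∈Cu with touched-component Cu (fresh-++ˡ (edges Cu) fr) u∈Cu (inj₁ refl)
    ... | path-end {vs = vs} {es} p u-end with ∈-++⁻ vs (WalkDecomposition.covers W v)
    ...   | inj₁ v∈p = close-path p R u-end (fresh-++ˡ es fr) v∈p
    ...   | inj₂ v∈R = join-components p R u-end (fresh-++ʳ es fr) v∈R

    insert : ∀ Cs → WalkDecomposition Cs → Fresh (allEdges Cs) → Inserted Cs
    insert Cs W fr =
      let Cu , R , Cs↭ , u∈Cu = component-containing Cs (WalkDecomposition.covers W u) in
      Inserted-↭ Cs↭ (insert-into Cu R (WalkDecomposition-↭ Cs↭ W) (fresh-↭ (concatMap-↭ edges Cs↭) fr) u∈Cu)

  singletons : List (Vtx G) → List WalkComponent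
  singletons = L.map (λ w → pathᵂ (stop w))

  allVertices-singletons : ∀ ws → allVertices (singletons ws) ≡ ws
  allVertices-singletons []       = refl
  allVertices-singletons (w ∷ ws) = cong (w ∷_) (allVertices-singletons ws)

  allEdges-singletons : ∀ ws → allEdges (singletons ws) ≡ []
  allEdges-singletons []       = refl
  allEdges-singletons (w ∷ ws) = allEdges-singletons ws

  singletons-decomposition : WalkDecomposition (singletons (L.allFin (n G)))
  singletons-decomposition = record
    { vertices-unique = subst Unique (sym (allVertices-singletons (L.allFin (n G)))) (allFin⁺ _)
    ; edges-unique    = subst Unique (sym (allEdges-singletons (L.allFin (n G)))) []
    ; covers          = λ w → subst (w ∈_) (sym (allVertices-singletons (L.allFin (n G)))) (∈-allFin w)
    }

  DecompositionOn : List (Edg G) → Set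
  DecompositionOn es = Σ (List WalkComponent) λ Cs → WalkDecomposition Cs × allEdges Cs ↭ es

  union-decomposition : ∀ es → Unique es → (∀ e → e ∈ es → InUnion e) → DecompositionOn es
  union-decomposition []       _  _     =
    singletons (L.allFin (n G)) , singletons-decomposition , ↭-reflexive (allEdges-singletons (L.allFin (n G)))
  union-decomposition (f ∷ es) ue union = extend (union-decomposition es (U.tail ue) (λ e e∈ → union e (there e∈)))
    where
      f∈ : InUnion f
      f∈ = union f (here refl)

      extend : DecompositionOn es → DecompositionOn (f ∷ es)
      extend (Cs , W , E↭) = add (Insertion.insert f f∈ Cs W fresh)
        where
          open WalkDecomposition W
          f∉ : f ∉ allEdges Cs
          f∉ f∈Cs = Unique[x∷xs]⇒x∉xs ue (∈-resp-↭ E↭ f∈Cs)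
          fresh : Insertion.Fresh f f∈ (allEdges Cs)
          fresh = record
            { unique = edges-unique ; inUnion = λ e e∈ → union e (there (∈-resp-↭ E↭ e∈)) ; f∉ = f∉ }
          add : Insertion.Inserted f f∈ Cs → DecompositionOn (f ∷ es)
          add (Cs′ , V↭ , E′↭) = Cs′ , W′ , ↭-trans E′↭ (↭-prep f E↭)
            where
              W′ : WalkDecomposition Cs′
              W′ = record
                { vertices-unique = Unique-resp-↭ (↭-sym V↭) vertices-unique
                ; edges-unique    = Unique-resp-↭ (↭-sym E′↭) (unique-∷ f∉ edges-unique)
                ; covers          = λ w → ∈-resp-↭ (↭-sym V↭) (covers w)
                }

  InUnion? : ∀ e → Dec (InUnion e)
  InUnion? e = (e ∈ₛ? H) ⊎-dec (e ∈ₛ? H′)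

  record UnionDecomposition : Set where
    field
      components    : List WalkComponent
      decomposition : WalkDecomposition components
      ⊆union        : ∀ e → e ∈ allEdges components → InUnion e
      union⊆        : ∀ e → InUnion e → e ∈ allEdges components

  unionDecomposition : UnionDecomposition
  unionDecomposition = complete (union-decomposition unionEdges (filter⁺ InUnion? (allFin⁺ _)) (λ e → inUnion e))
    where
      unionEdges : List (Edg G)
      unionEdges = L.filter InUnion? (L.allFin (m G))
      inUnion : ∀ e → e ∈ unionEdges → InUnion e
      inUnion e e∈ = proj₂ (∈-filter⁻ InUnion? {xs = L.allFin (m G)} e∈)
      complete : DecompositionOn unionEdges → UnionDecomposition
      complete (Cs , W , E↭) = record
        { components    = Cs
        ; decomposition = W
        ; ⊆union        = λ e e∈ → inUnion e (∈-resp-↭ E↭ e∈)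
        ; union⊆        = λ e e∈ → ∈-resp-↭ (↭-sym E↭) (∈-filter⁺ InUnion? (∈-allFin e) e∈)
        }

  matchings⇒decomposition : Σ (PecDecomp G) λ D →
    pCount G D + (∣ H ∣ + ∣ H′ ∣) ≡ n G × ∣ H ∣ + eCount G D ≤ ∣ H′ ∣ + pCount G D
  matchings⇒decomposition = toPecDecomp decomposition , size , balance
    where
      open UnionDecomposition unionDecomposition
      open WalkDecomposition decomposition
      Cs : List WalkComponent
      Cs = components
      E : List (Edg G)
      E = allEdges Cs

      ∣H∣ : ∣ H ∣ ≡ #H E
      ∣H∣ = ∣S∣≡countᵇ H edges-unique (λ e e∈H → union⊆ e (inj₁ e∈H))

      ∣H′∣ : ∣ H′ ∣ ≡ #H′ E
      ∣H′∣ = trans (∣S∣≡countᵇ H′ edges-unique (λ e e∈H′ → union⊆ e (inj₂ e∈H′)))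
                   (countᵇ-cong _ _ E (λ e e∈ → lookup-H′ (⊆union e e∈)))

      size : pCount G (toPecDecomp decomposition) + (∣ H ∣ + ∣ H′ ∣) ≡ n G
      size = begin
        pCount G (toPecDecomp decomposition) + (∣ H ∣ + ∣ H′ ∣)
          ≡⟨ cong₂ _+_ (pCount-toPecDecomp decomposition) (cong₂ _+_ ∣H∣ ∣H′∣) ⟩
        countᵇ isPathᵂ Cs + (#H E + #H′ E) ≡⟨ cong (countᵇ isPathᵂ Cs +_) (countᵇ-+-not inH E) ⟩
        countᵇ isPathᵂ Cs + length E       ≡⟨ +-comm (countᵇ isPathᵂ Cs) (length E) ⟩
        length E + countᵇ isPathᵂ Cs       ≡⟨ length-allVertices Cs ⟨
        length (allVertices Cs)            ≡⟨ n≡length-allVertices decomposition ⟨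
        n G                                ∎
        where open ≡-Reasoning

      balance : ∣ H ∣ + eCount G (toPecDecomp decomposition) ≤ ∣ H′ ∣ + pCount G (toPecDecomp decomposition)
      balance = subst₂ _≤_ (sym (cong₂ _+_ ∣H∣ (eCount-toPecDecomp decomposition)))
                           (sym (cong₂ _+_ ∣H′∣ (pCount-toPecDecomp decomposition)))
                  (decomposition-balance Cs edges-unique ⊆union)

module Optimality where

  open AlternatingMatchings using (decomposition⇒matchings)
  open MatchingUnion using (matchings⇒decomposition)
  open import Data.Nat using (ℕ; _+_; _≤_)
  open import Data.Nat.Properties using (≤-antisym; +-mono-≤; +-monoʳ-≤; +-monoˡ-≤; +-cancelʳ-≡; +-comm; +-assoc; module ≤-Reasoning)
  open import Data.Fin.Subset using (∣_∣)
  open import Data.Product using (_,_; proj₁; proj₂)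
  open import Relation.Binary.PropositionalEquality using (_≡_; refl; sym; trans; cong; subst₂)

  module _ (G : Graph) {l p : ℕ} (isλ : IsLambda G l) (isP : IsP G p) where

    n≤λ+p : n G ≤ l + p
    n≤λ+p with proj₁ isP
    ... | D , refl with decomposition⇒matchings G D
    ...   | H , H′ , dm , size , _ = subst₂ _≤_ size refl (+-monoˡ-≤ (pCount G D) (proj₂ isλ H H′ dm))

    λ+p≤n : l + p ≤ n G
    λ+p≤n with proj₁ isλ
    ... | H , H′ , dm , refl with matchings⇒decomposition G dm
    ...   | D , size , _ = begin
      ∣ H ∣ + ∣ H′ ∣ + p            ≤⟨ +-monoʳ-≤ (∣ H ∣ + ∣ H′ ∣) (proj₂ isP D) ⟩
      ∣ H ∣ + ∣ H′ ∣ + pCount G D   ≡⟨ +-comm (∣ H ∣ + ∣ H′ ∣) _ ⟩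
      pCount G D + (∣ H ∣ + ∣ H′ ∣) ≡⟨ size ⟩
      n G                           ∎
      where open ≤-Reasoning

    λ+p≡n : l + p ≡ n G
    λ+p≡n = ≤-antisym λ+p≤n n≤λ+p

  module _ (G : Graph) {l k p e : ℕ}
           (isλ : IsLambda G l) (isμ : IsMu G l k) (isP : IsP G p) (isEp : IsEp G p e) where

    2μ+e≤λ+p : k + k + e ≤ l + p
    2μ+e≤λ+p with proj₁ isμ
    ... | H , H′ , (dm , refl) , refl with matchings⇒decomposition G dm
    ...   | D , size , balance = begin
      ∣ H ∣ + ∣ H ∣ + e              ≡⟨ +-assoc ∣ H ∣ ∣ H ∣ e ⟩
      ∣ H ∣ + (∣ H ∣ + e)            ≤⟨ +-monoʳ-≤ ∣ H ∣ (+-monoʳ-≤ ∣ H ∣ (proj₂ isEp D pCount≡p)) ⟩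
      ∣ H ∣ + (∣ H ∣ + eCount G D)   ≤⟨ +-monoʳ-≤ ∣ H ∣ balance ⟩
      ∣ H ∣ + (∣ H′ ∣ + pCount G D)  ≡⟨ cong (λ q → ∣ H ∣ + (∣ H′ ∣ + q)) pCount≡p ⟩
      ∣ H ∣ + (∣ H′ ∣ + p)           ≡⟨ +-assoc ∣ H ∣ ∣ H′ ∣ p ⟨
      ∣ H ∣ + ∣ H′ ∣ + p             ∎
      where
        open ≤-Reasoning
        pCount≡p : pCount G D ≡ p
        pCount≡p = +-cancelʳ-≡ l (pCount G D) p (trans size (trans (sym (λ+p≡n G isλ isP)) (+-comm l p)))

    λ+p≤2μ+e : l + p ≤ k + k + e
    λ+p≤2μ+e with proj₁ isEp
    ... | D , refl , refl with decomposition⇒matchings G D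
    ...   | H , H′ , dm , size , balance = begin
      l + pCount G D                ≡⟨ cong (_+ pCount G D) H+H′≡λ ⟨
      ∣ H ∣ + ∣ H′ ∣ + pCount G D   ≡⟨ +-assoc ∣ H ∣ ∣ H′ ∣ _ ⟩
      ∣ H ∣ + (∣ H′ ∣ + pCount G D) ≡⟨ cong (∣ H ∣ +_) balance ⟨
      ∣ H ∣ + (∣ H ∣ + eCount G D)  ≤⟨ +-mono-≤ H≤μ (+-monoˡ-≤ (eCount G D) H≤μ) ⟩
      k + (k + eCount G D)          ≡⟨ +-assoc k k _ ⟨
      k + k + eCount G D            ∎
      where
        open ≤-Reasoning
        H+H′≡λ : ∣ H ∣ + ∣ H′ ∣ ≡ l
        H+H′≡λ = +-cancelʳ-≡ (pCount G D) _ l (trans size (sym (λ+p≡n G isλ isP)))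
        H≤μ : ∣ H ∣ ≤ k
        H≤μ = proj₂ isμ H H′ (dm , H+H′≡λ)

    2μ+e≡λ+p : k + k + e ≡ l + p
    2μ+e≡λ+p = ≤-antisym 2μ+e≤λ+p λ+p≤2μ+e

open Optimality
open import Data.Nat using (ℕ)
import Data.Nat as ℕ
open import Data.Integer using (ℤ; +_; _-_; _+_; _*_)
open import Data.Integer.Properties using (pos-+)
import Data.Integer.Solver as ℤ-Solver
open import Data.Product using (_×_; _,_)
open import Relation.Binary.PropositionalEquality using (_≡_; refl; sym; trans; cong; module ≡-Reasoning)

integer-identities : ∀ (k l p e n : ℕ) → k ℕ.+ k ℕ.+ e ≡ l ℕ.+ p → l ℕ.+ p ≡ n →
  ((+ k) - ((+ l) - (+ k)) ≡ (+ p) - (+ e)) × ((+ 2) * ((+ l) - (+ k)) ≡ ((+ n) - (+ 2) * (+ p)) + (+ e))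
integer-identities k l p e n 2μ+e≡λ+p λ+p≡n = first , second
  where
    open ℤ-Solver.+-*-Solver
    open ≡-Reasoning
    K L P E N : ℤ
    K = + k
    L = + l
    P = + p
    E = + e
    N = + n
    2K+E≡L+P : K + K + E ≡ L + P
    2K+E≡L+P = trans (sym (trans (pos-+ (k ℕ.+ k) e) (cong (_+ E) (pos-+ k k)))) (trans (cong +_ 2μ+e≡λ+p) (pos-+ l p))
    L+P≡N : L + P ≡ N
    L+P≡N = trans (sym (pos-+ l p)) (cong +_ λ+p≡n)
    first : K - (L - K) ≡ P - E
    first = begin
      K - (L - K)              ≡⟨ solve 3 (λ K L E → K :- (L :- K) := ((K :+ K :+ E) :- L) :- E) refl K L E ⟩
      ((K + K + E) - L) - E    ≡⟨ cong (λ z → (z - L) - E) 2K+E≡L+P ⟩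
      ((L + P) - L) - E        ≡⟨ solve 3 (λ L P E → ((L :+ P) :- L) :- E := P :- E) refl L P E ⟩
      P - E                    ∎
    second : + 2 * (L - K) ≡ (N - + 2 * P) + E
    second = begin
      + 2 * (L - K)
        ≡⟨ solve 3 (λ K L E → con (+ 2) :* (L :- K) := ((L :+ L) :- (K :+ K :+ E)) :+ E) refl K L E ⟩
      ((L + L) - (K + K + E)) + E
        ≡⟨ cong (λ z → ((L + L) - z) + E) 2K+E≡L+P ⟩
      ((L + L) - (L + P)) + E
        ≡⟨ solve 3 (λ L P E → ((L :+ L) :- (L :+ P)) :+ E := ((L :+ P) :- con (+ 2) :* P) :+ E) refl L P E ⟩
      ((L + P) - + 2 * P) + E
        ≡⟨ cong (λ z → (z - + 2 * P) + E) L+P≡N ⟩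
      (N - + 2 * P) + E ∎

mainTheorem10 : (G : Graph) (l k p e : ℕ) →
    IsLambda G l → IsMu G l k → IsP G p → IsEp G p e →
    ((+ k) - ((+ l) - (+ k)) ≡ (+ p) - (+ e))
    × ((+ 2) * ((+ l) - (+ k)) ≡ ((+ n G) - (+ 2) * (+ p)) + (+ e))
mainTheorem10 G l k p e isλ isμ isP isEp =
  integer-identities k l p e (n G) (2μ+e≡λ+p G isλ isμ isP isEp) (λ+p≡n G isλ isP)
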